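{- For every well-typed iso $\vdash_\omega\omega:A\leftrightarrow B$ and every well-typed closed value $\vdash_e v:B$, if $\omega\,(\omega^\perp\,v)\to^* v'$ with $v'$ a value, then $v=v'$.
   Context: Types: $A,B ::= \mathbb{1} \mid A\oplus B \mid A\otimes B \mid \mu X.A \mid X$ ($\mu$ binds $X$; only closed types are used; $A[X\leftarrow C]$ is substitution). Iso types: $\alpha ::= A\leftrightarrow B$. Syntax: values $v ::= () \mid x \mid \mathtt{inl}\,v \mid \mathtt{inr}\,v \mid \langle v_1,v_2\rangle \mid \mathtt{fold}\,v$; patterns $p ::= x \mid \langle p_1,p_2\rangle$; expressions $e ::= v \mid \mathtt{let}\,p_1=\omega\,p_2\,\mathtt{in}\,e$; isos $\omega ::= \{v_1\leftrightarrow e_1\mid\dots\mid v_n\leftrightarrow e_n\} \mid \mathtt{fix}\,f.\omega \mid f$ ($f$ an iso-variable); terms $t ::= () \mid x \mid \mathtt{inl}\,t\mid\mathtt{inr}\,t\mid\langle t_1,t_2\rangle\mid\mathtt{fold}\,t\mid \omega\,t\mid \mathtt{let}\,p=t_1\,\mathtt{in}\,t_2$. $(x_1,\dots,x_n)$ abbreviates $\langle x_1,\langle\dots,x_n\rangle\rangle$ and $A_1\otimes\dots\otimes A_n$ is right-nested. Terms are taken up to $\alpha$-conversion with all bound and free variable names distinct. Typing of terms $\Delta;\Psi\vdash_e t:A$, where $\Delta$ is a set of pairs $x:A$ (each variable at most once) and $\Psi$ is empty or a single pair $f:\alpha$: $\emptyset;\Psi\vdash_e():\mathbb{1}$; $x:A;\Psi\vdash_e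 x:A$; from $\Delta;\Psi\vdash_e t:A$ infer $\Delta;\Psi\vdash_e\mathtt{inl}\,t:A\oplus B$; from $\Delta;\Psi\vdash_e t:B$ infer $\Delta;\Psi\vdash_e\mathtt{inr}\,t:A\oplus B$; from $\Delta_1;\Psi\vdash_e t_1:A$ and $\Delta_2;\Psi\vdash_e t_2:B$ infer $\Delta_1,\Delta_2;\Psi\vdash_e\langle t_1,t_2\rangle:A\otimes B$; from $\Delta;\Psi\vdash_e t:A[X\leftarrow\mu X.A]$ infer $\Delta;\Psi\vdash_e\mathtt{fold}\,t:\mu X.A$; from $\Psi\vdash_\omega f:A\leftrightarrow B$ and $\Delta;\Psi\vdash_e t:A$ infer $\Delta;\Psi\vdash_e f\,t:B$; from $\vdash_\omega\omega:A\leftrightarrow B$ (empty iso-context) and $\Delta;\Psi\vdash_e t:A$ infer $\Delta;\Psi\vdash_e\omega\,t:B$; from $\Delta_1;\Psi\vdash_e t_1:A_1\otimes\dots\otimes A_n$ and $\Delta_2,x_1:A_1,\dots,x_n:A_n;\Psi\vdash_e t_2:B$ infer $\Delta_1,\Delta_2;\Psi\vdash_e\mathtt{let}\,(x_1,\dots,x_n)=t_1\,\mathtt{in}\,t_2:B$. $\vdash_e t:A$ means both contexts are empty. Typing of isos $\Psi\vdash_\omega\omega:\alpha$: (i) if for each $i$, $\Delta_i\vdash_e v_i:A$ and $\Delta_i;\Psi\vdash_e e_i:B$, and $\mathtt{OD}_A(\{v_1,\dots,v_n\})$ and $\mathtt{OD}_B(\{Val(e_1),\dots,Val(e_n)\})$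 hold, then $\Psi\vdash_\omega\{v_1\leftrightarrow e_1\mid\dots\mid v_n\leftrightarrow e_n\}:A\leftrightarrow B$, where $Val(\mathtt{let}\,p=\omega\,p'\,\mathtt{in}\,e)=Val(e)$ and $Val(v)=v$; (ii) $f:\alpha\vdash_\omega f:\alpha$; (iii) if $f:\alpha\vdash_\omega\omega:\alpha$ and $\mathtt{fix}\,f.\omega$ is structurally recursive, then $\Psi\vdash_\omega\mathtt{fix}\,f.\omega:\alpha$. Structural recursion: $\mathtt{fix}\,f.\{v_1\leftrightarrow e_1\mid\dots\mid v_n\leftrightarrow e_n\}:A_1\otimes\dots\otimes A_m\leftrightarrow C$ is structurally recursive if there is $1\le j\le m$ with $A_j=\mu X.B$ such that for each $i$, $v_i=(v_i^1,\dots,v_i^m)$ and either $v_i^j$ is closed and $e_i$ contains no subterm $f\,p$, or $v_i^j$ is open and every subterm $f\,p$ of $e_i$ has $p=(x_1,\dots,x_m)$ with $x_j:\mu X.B$ a strict subterm of $v_i^j$. $\mathtt{OD}_A(S)$ is defined inductively: $\mathtt{OD}_A(\{x\})$; $\mathtt{OD}_{\mathbb{1}}(\{()\})$; if $\mathtt{OD}_A(S)$ and $\mathtt{OD}_B(T)$ then $\mathtt{OD}_{A\oplus B}(\{\mathtt{inl}\,v\mid v\in S\}\cup\{\mathtt{inr}\,v\mid v\in T\})$; if $\mathtt{OD}_{A[X\leftarrow\mu X.A]}(S)$ then $\mathtt{OD}_{\mu X.A}(\{\mathtt{fold}\,v\mid v\in S\})$; for a set $S$ of pairs, $\mathtt{OD}_{A\otimes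 B}(S)$ if either ($\mathtt{OD}_A(\pi_1 S)$ and $\forall v\in\pi_1 S$, $\mathtt{OD}_B(\{w\mid\langle v,w\rangle\in S\})$) or ($\mathtt{OD}_B(\pi_2 S)$ and $\forall v\in\pi_2 S$, $\mathtt{OD}_A(\{w\mid\langle w,v\rangle\in S\})$), with $\pi_1 S=\{v\mid\langle v,w\rangle\in S\}$, $\pi_2 S=\{w\mid\langle v,w\rangle\in S\}$. Substitutions $\sigma$ map variables to values; $\sigma(t)$ replaces each $x$ with $(x\mapsto v)\in\sigma$ by $v$ (homomorphically, not capturing let-bound variables). Pattern matching $\sigma[v]=v'$: $\sigma[x]=e$ when $\sigma=\{x\mapsto e\}$; $\sigma[()]=()$; $\sigma[\mathtt{inl}\,e]=\mathtt{inl}\,e'$ if $\sigma[e]=e'$, similarly for $\mathtt{inr}$, $\mathtt{fold}$; $\sigma[\langle e_1,e_2\rangle]=\langle e_1',e_2'\rangle$ if $\sigma_1[e_1]=e_1'$, $\sigma_2[e_2]=e_2'$, $\sigma_1,\sigma_2$ have disjoint supports and $\sigma=\sigma_1\cup\sigma_2$. Evaluation contexts: $C ::= [\,] \mid \mathtt{inl}\,C\mid\mathtt{inr}\,C\mid\omega\,C\mid\mathtt{let}\,p=C\,\mathtt{in}\,t\mid\langle C,v\rangle\mid\langle v,C\rangle\mid\mathtt{fold}\,C\mid C\,t$. Reduction $\to$: if $t_1\to t_2$ then $C[t_1]\to C[t_2]$; $\mathtt{let}\,p=v\,\mathtt{in}\,t\to\sigma(t)$ if $\sigma[p]=v$; $\mathtt{fix}\,f.\omega\to\omega[f:=\mathtt{fix}\,f.\omega]$;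 $\{v_1\leftrightarrow e_1\mid\dots\mid v_n\leftrightarrow e_n\}\,v'\to\sigma(e_i)$ if $\sigma[v_i]=v'$. $\to^*$ is the reflexive transitive closure. Inversion: $f^\perp=f$; $(\mathtt{fix}\,f.\omega)^\perp=\mathtt{fix}\,f.\omega^\perp$; $\{(v_i\leftrightarrow e_i)_{i\in I}\}^\perp=\{((v_i\leftrightarrow e_i)^\perp)_{i\in I}\}$, where for a clause $v_1\leftrightarrow \mathtt{let}\,p_1=\omega_1\,p_1'\,\mathtt{in}\cdots\mathtt{let}\,p_n=\omega_n\,p_n'\,\mathtt{in}\,v_1'$ its inverse is $v_1'\leftrightarrow\mathtt{let}\,p_n'=\omega_n^\perp\,p_n\,\mathtt{in}\cdots\mathtt{let}\,p_1'=\omega_1^\perp\,p_1\,\mathtt{in}\,v_1$. -}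

module Defs where

open import Data.Nat using (ℕ; zero; suc; _≡ᵇ_)
open import Data.Bool using (Bool; true; false; if_then_else_; _∨_)
open import Data.Fin using (Fin; zero; suc)
open import Data.Maybe using (Maybe; just; nothing; maybe)
open import Data.List using (List; []; _∷_; [_]; _++_; map; concatMap)
open import Data.Vec using (Vec; []; _∷_; lookup)
open import Data.Product using (Σ; _×_; _,_; proj₁; proj₂)
open import Data.Sum using (_⊎_)
open import Data.Empty using (⊥)
open import Data.Unit using (⊤)
open import Relation.Nullary using (¬_)
open import Relation.Binary.PropositionalEquality using (_≡_)
open import Data.List.Relation.Unary.All using (All)
open import Data.List.Membership.Propositional using (_∈_)
open import Data.List.Relation.Unary.Unique.Propositional using (Unique)
open import Data.List.Relation.Binary.Disjoint.Propositional using (Disjoint)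
open import Data.List.Relation.Binary.Permutation.Propositional using (_↭_)
open import Relation.Binary.Construct.Closure.ReflexiveTransitive using (Star)

-- Types (type variables in de Bruijn form; Ty 0 = closed types)

data Ty : ℕ → Set where
  𝟙    : ∀ {n} → Ty n
  _⊕_  : ∀ {n} → Ty n → Ty n → Ty n
  _⊗_  : ∀ {n} → Ty n → Ty n → Ty n
  μ    : ∀ {n} → Ty (suc n) → Ty n
  tvar : ∀ {n} → Fin n → Ty n

infixr 6 _⊕_
infixr 7 _⊗_

extRen : ∀ {n m} → (Fin n → Fin m) → Fin (suc n) → Fin (suc m)
extRen ρ zero = zero
extRen ρ (suc i) = suc (ρ i)

renTy : ∀ {n m} → (Fin n → Fin m) → Ty n → Ty m
renTy ρ 𝟙 = 𝟙
renTy ρ (A ⊕ B) = renTy ρ A ⊕ renTy ρ B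
renTy ρ (A ⊗ B) = renTy ρ A ⊗ renTy ρ B
renTy ρ (μ A) = μ (renTy (extRen ρ) A)
renTy ρ (tvar i) = tvar (ρ i)

extSub : ∀ {n m} → (Fin n → Ty m) → Fin (suc n) → Ty (suc m)
extSub σ zero = tvar zero
extSub σ (suc i) = renTy suc (σ i)

subTy : ∀ {n m} → (Fin n → Ty m) → Ty n → Ty m
subTy σ 𝟙 = 𝟙
subTy σ (A ⊕ B) = subTy σ A ⊕ subTy σ B
subTy σ (A ⊗ B) = subTy σ A ⊗ subTy σ B
subTy σ (μ A) = μ (subTy (extSub σ) A)
subTy σ (tvar i) = σ i

_[X←_] : Ty 1 → Ty 0 → Ty 0
A [X← C ] = subTy (λ _ → C) A

data IsoTy : Set where
  _↔_ : Ty 0 → Ty 0 → IsoTy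

tupTy : ∀ {k} → Vec (Ty 0) (suc k) → Ty 0
tupTy (A ∷ []) = A
tupTy (A ∷ B ∷ As) = A ⊗ tupTy (B ∷ As)

-- Syntax (term variables and iso variables are names in ℕ)

data Val : Set where
  unit : Val
  var  : ℕ → Val
  inl  : Val → Val
  inr  : Val → Val
  pair : Val → Val → Val
  fold : Val → Val

data Pat : Set where
  pvar  : ℕ → Pat
  ppair : Pat → Pat → Pat

mutual
  data Expr : Set where
    val  : Val → Expr
    elet : Pat → Iso → Pat → Expr → Expr     -- let p₁ = ω p₂ in e

  data Iso : Set where
    clauses : List (Val × Expr) → Iso
    fix     : ℕ → Iso → Iso
    ivar    : ℕ → Iso

data Term : Set where
  unit : Term
  var  : ℕ → Term
  inl  : Term → Term
  inr  : Term → Term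
  pair : Term → Term → Term
  fold : Term → Term
  app  : Iso → Term → Term
  tlet : Pat → Term → Term → Term

valT : Val → Term
valT unit = unit
valT (var x) = var x
valT (inl v) = inl (valT v)
valT (inr v) = inr (valT v)
valT (pair v w) = pair (valT v) (valT w)
valT (fold v) = fold (valT v)

patVal : Pat → Val
patVal (pvar x) = var x
patVal (ppair p q) = pair (patVal p) (patVal q)

patVars : Pat → List ℕ
patVars (pvar x) = [ x ]
patVars (ppair p q) = patVars p ++ patVars q

tupPat : ∀ {k} → Vec ℕ (suc k) → Pat
tupPat (x ∷ []) = pvar x
tupPat (x ∷ y ∷ xs) = ppair (pvar x) (tupPat (y ∷ xs))

tupVal : ∀ {k} → Vec Val (suc k) → Val
tupVal (v ∷ []) = v
tupVal (v ∷ w ∷ vs) = pair v (tupVal (w ∷ vs))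

toTerm : Expr → Term
toTerm (val v) = valT v
toTerm (elet p ω p′ e) = tlet p (app ω (valT (patVal p′))) (toTerm e)

valOf : Expr → Val
valOf (val v) = v
valOf (elet _ _ _ e) = valOf e

-- Orthogonality OD_A(S).  The clause values {v₁,…,vₙ} are read as a
-- family (multiset, given as a list); π₁ S / π₂ S are sets (the list of
-- keys of KF, each with its fibre).

data OD : Ty 0 → List Val → Set where
  od-var   : ∀ {A x} → OD A [ var x ]
  od-unit  : OD 𝟙 [ unit ]
  od-sum   : ∀ {A B S S₁ S₂} → S ↭ (map inl S₁ ++ map inr S₂) →
             OD A S₁ → OD B S₂ → OD (A ⊕ B) S
  od-fold  : ∀ {A S} → OD (A [X← μ A ]) S → OD (μ A) (map fold S)
  od-pairL : ∀ {A B S} (KF : List (Val × List Val)) →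
             S ↭ concatMap (λ kw → map (pair (proj₁ kw)) (proj₂ kw)) KF →
             OD A (map proj₁ KF) → All (λ kw → OD B (proj₂ kw)) KF →
             OD (A ⊗ B) S
  od-pairR : ∀ {A B S} (KF : List (Val × List Val)) →
             S ↭ concatMap (λ kw → map (λ w → pair w (proj₁ kw)) (proj₂ kw)) KF →
             OD B (map proj₁ KF) → All (λ kw → OD A (proj₂ kw)) KF →
             OD (A ⊗ B) S

Closed : Val → Set
Closed unit = ⊤
Closed (var _) = ⊥
Closed (inl v) = Closed v
Closed (inr v) = Closed v
Closed (pair v w) = Closed v × Closed w
Closed (fold v) = Closed v

data Occurs (x : ℕ) : Val → Set where
  here  : Occurs x (var x)
  inl   : ∀ {v} → Occurs x v → Occurs x (inl v)
  inr   : ∀ {v} → Occurs x v → Occurs x (inr v)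
  fold  : ∀ {v} → Occurs x v → Occurs x (fold v)
  pairˡ : ∀ {v w} → Occurs x v → Occurs x (pair v w)
  pairʳ : ∀ {v w} → Occurs x w → Occurs x (pair v w)

data StrictSub (x : ℕ) : Val → Set where
  inl   : ∀ {v} → Occurs x v → StrictSub x (inl v)
  inr   : ∀ {v} → Occurs x v → StrictSub x (inr v)
  fold  : ∀ {v} → Occurs x v → StrictSub x (fold v)
  pairˡ : ∀ {v w} → Occurs x v → StrictSub x (pair v w)
  pairʳ : ∀ {v w} → Occurs x w → StrictSub x (pair v w)

headCall : ℕ → Iso → Pat → List Pat
headCall f (ivar g) p′ = if f ≡ᵇ g then [ p′ ] else []
headCall f _ p′ = []

mutual
  callsE : ℕ → Expr → List Pat
  callsE f (val _) = []
  callsE f (elet p ω p′ e) = headCall f ω p′ ++ callsI f ω ++ callsE f e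

  callsI : ℕ → Iso → List Pat
  callsI f (clauses cs) = callsCs f cs
  callsI f (fix _ ω) = callsI f ω
  callsI f (ivar _) = []

  callsCs : ℕ → List (Val × Expr) → List Pat
  callsCs f [] = []
  callsCs f ((_ , e) ∷ cs) = callsE f e ++ callsCs f cs

SRClause : ℕ → ∀ {k} → Fin (suc k) → Val × Expr → Set
SRClause f {k} j (v , e) =
  Σ (Vec Val (suc k)) λ vs → v ≡ tupVal vs ×
    ((Closed (lookup vs j) × callsE f e ≡ [])
     ⊎ (¬ Closed (lookup vs j) ×
        All (λ p → Σ (Vec ℕ (suc k)) λ xs → p ≡ tupPat xs ×
                     StrictSub (lookup xs j) (lookup vs j))
            (callsE f e)))

StructRec : ℕ → Iso → IsoTy → Set
StructRec f (clauses cs) (A ↔ C) =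
  Σ ℕ λ k → Σ (Vec (Ty 0) (suc k)) λ As → A ≡ tupTy As ×
    Σ (Fin (suc k)) λ j → (Σ (Ty 1) λ B → lookup As j ≡ μ B) ×
      All (SRClause f j) cs
StructRec f (fix _ _) _ = ⊥
StructRec f (ivar _) _ = ⊥

Ctx : Set
Ctx = List (ℕ × Ty 0)

IsoCtx : Set
IsoCtx = Maybe (ℕ × IsoTy)

data PatTy : Pat → Ty 0 → Ctx → Set where
  pt-var  : ∀ {x A} → PatTy (pvar x) A [ (x , A) ]
  pt-pair : ∀ {x p A B Δ} → PatTy p B Δ → PatTy (ppair (pvar x) p) (A ⊗ B) ((x , A) ∷ Δ)

infix 4 _︔_⊢_∶_ _⊢ω_∶_

mutual
  data _︔_⊢_∶_ : Ctx → IsoCtx → Term → Ty 0 → Set where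
    t-unit : ∀ {Ψ} → [] ︔ Ψ ⊢ unit ∶ 𝟙
    t-var  : ∀ {Ψ x A} → [ (x , A) ] ︔ Ψ ⊢ var x ∶ A
    t-inl  : ∀ {Δ Ψ t A B} → Δ ︔ Ψ ⊢ t ∶ A → Δ ︔ Ψ ⊢ inl t ∶ A ⊕ B
    t-inr  : ∀ {Δ Ψ t A B} → Δ ︔ Ψ ⊢ t ∶ B → Δ ︔ Ψ ⊢ inr t ∶ A ⊕ B
    t-pair : ∀ {Δ Δ₁ Δ₂ Ψ t₁ t₂ A B} →
             Δ₁ ︔ Ψ ⊢ t₁ ∶ A → Δ₂ ︔ Ψ ⊢ t₂ ∶ B →
             Δ ↭ (Δ₁ ++ Δ₂) → Unique (map proj₁ Δ) →
             Δ ︔ Ψ ⊢ pair t₁ t₂ ∶ A ⊗ B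
    t-fold : ∀ {Δ Ψ t A} → Δ ︔ Ψ ⊢ t ∶ A [X← μ A ] → Δ ︔ Ψ ⊢ fold t ∶ μ A
    t-appf : ∀ {Δ Ψ f t A B} → Ψ ⊢ω ivar f ∶ (A ↔ B) → Δ ︔ Ψ ⊢ t ∶ A →
             Δ ︔ Ψ ⊢ app (ivar f) t ∶ B
    t-app  : ∀ {Δ Ψ ω t A B} → nothing ⊢ω ω ∶ (A ↔ B) → Δ ︔ Ψ ⊢ t ∶ A →
             Δ ︔ Ψ ⊢ app ω t ∶ B
    t-let  : ∀ {Δ Δ₁ Δ₂ Δp Ψ p t₁ t₂ A B} →
             PatTy p A Δp →
             Δ₁ ︔ Ψ ⊢ t₁ ∶ A → (Δ₂ ++ Δp) ︔ Ψ ⊢ t₂ ∶ B →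
             Δ ↭ (Δ₁ ++ Δ₂) → Unique (map proj₁ Δ) →
             Δ ︔ Ψ ⊢ tlet p t₁ t₂ ∶ B

  data ClauseTy (Ψ : IsoCtx) (A B : Ty 0) : Val × Expr → Set where
    clause : ∀ {v e} (Δ : Ctx) → Δ ︔ nothing ⊢ valT v ∶ A → Δ ︔ Ψ ⊢ toTerm e ∶ B →
             ClauseTy Ψ A B (v , e)

  data _⊢ω_∶_ : IsoCtx → Iso → IsoTy → Set where
    i-clauses : ∀ {Ψ cs A B} → All (ClauseTy Ψ A B) cs →
                OD A (map proj₁ cs) → OD B (map (λ c → valOf (proj₂ c)) cs) →
                Ψ ⊢ω clauses cs ∶ (A ↔ B)
    i-var     : ∀ {f α} → just (f , α) ⊢ω ivar f ∶ α
    i-fix     : ∀ {Ψ f ω α} → just (f , α) ⊢ω ω ∶ α → StructRec f ω α →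
                Ψ ⊢ω fix f ω ∶ α

Subst : Set
Subst = List (ℕ × Val)

dom : Subst → List ℕ
dom = map proj₁

data Match : Subst → Val → Val → Set where
  m-var  : ∀ {x w} → Match [ (x , w) ] (var x) w
  m-unit : Match [] unit unit
  m-inl  : ∀ {σ v w} → Match σ v w → Match σ (inl v) (inl w)
  m-inr  : ∀ {σ v w} → Match σ v w → Match σ (inr v) (inr w)
  m-fold : ∀ {σ v w} → Match σ v w → Match σ (fold v) (fold w)
  m-pair : ∀ {σ₁ σ₂ v₁ v₂ w₁ w₂} → Match σ₁ v₁ w₁ → Match σ₂ v₂ w₂ →
           Disjoint (dom σ₁) (dom σ₂) →
           Match (σ₁ ++ σ₂) (pair v₁ v₂) (pair w₁ w₂)

lookupS : Subst → ℕ → Maybe Val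
lookupS [] x = nothing
lookupS ((y , v) ∷ σ) x = if x ≡ᵇ y then just v else lookupS σ x

elemℕ : ℕ → List ℕ → Bool
elemℕ x [] = false
elemℕ x (y ∷ ys) = (x ≡ᵇ y) ∨ elemℕ x ys

removeS : List ℕ → Subst → Subst
removeS xs [] = []
removeS xs ((y , v) ∷ σ) = if elemℕ y xs then removeS xs σ else (y , v) ∷ removeS xs σ

-- σ(t); isos occurring in terms are closed (no free term variables)
substT : Subst → Term → Term
substT σ unit = unit
substT σ (var x) = maybe valT (var x) (lookupS σ x)
substT σ (inl t) = inl (substT σ t)
substT σ (inr t) = inr (substT σ t)
substT σ (pair t u) = pair (substT σ t) (substT σ u)
substT σ (fold t) = fold (substT σ t)
substT σ (app ω t) = app ω (substT σ t)
substT σ (tlet p t u) = tlet p (substT σ t) (substT (removeS (patVars p) σ) u)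

mutual
  substI : ℕ → Iso → Iso → Iso
  substI f ω′ (clauses cs) = clauses (substCs f ω′ cs)
  substI f ω′ (fix g ω) = if f ≡ᵇ g then fix g ω else fix g (substI f ω′ ω)
  substI f ω′ (ivar g) = if f ≡ᵇ g then ω′ else ivar g

  substCs : ℕ → Iso → List (Val × Expr) → List (Val × Expr)
  substCs f ω′ [] = []
  substCs f ω′ ((v , e) ∷ cs) = (v , substE f ω′ e) ∷ substCs f ω′ cs

  substE : ℕ → Iso → Expr → Expr
  substE f ω′ (val v) = val v
  substE f ω′ (elet p ω p′ e) = elet p (substI f ω′ ω) p′ (substE f ω′ e)

infix 4 _⟶ᵢ_ _⟶_ _⟶*_

data _⟶ᵢ_ : Iso → Iso → Set where
  fix-unfold : ∀ {f ω} → fix f ω ⟶ᵢ substI f (fix f ω) ω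

data _⟶_ : Term → Term → Set where
  r-inl    : ∀ {t t′} → t ⟶ t′ → inl t ⟶ inl t′
  r-inr    : ∀ {t t′} → t ⟶ t′ → inr t ⟶ inr t′
  r-arg    : ∀ {ω t t′} → t ⟶ t′ → app ω t ⟶ app ω t′
  r-let    : ∀ {p t t′ u} → t ⟶ t′ → tlet p t u ⟶ tlet p t′ u
  r-pairˡ  : ∀ {t t′ v} → t ⟶ t′ → pair t (valT v) ⟶ pair t′ (valT v)
  r-pairʳ  : ∀ {t t′ v} → t ⟶ t′ → pair (valT v) t ⟶ pair (valT v) t′
  r-fold   : ∀ {t t′} → t ⟶ t′ → fold t ⟶ fold t′
  r-iso    : ∀ {ω ω′ t} → ω ⟶ᵢ ω′ → app ω t ⟶ app ω′ t
  r-letβ   : ∀ {σ p v t} → Match σ (patVal p) v → tlet p (valT v) t ⟶ substT σ t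
  r-clause : ∀ {σ cs v e w} → (v , e) ∈ cs → Match σ v w →
             app (clauses cs) (valT w) ⟶ substT σ (toTerm e)

_⟶*_ : Term → Term → Set
_⟶*_ = Star _⟶_

mutual
  inv : Iso → Iso
  inv (ivar f) = ivar f
  inv (fix f ω) = fix f (inv ω)
  inv (clauses cs) = clauses (invCs cs)

  invCs : List (Val × Expr) → List (Val × Expr)
  invCs [] = []
  invCs ((v , e) ∷ cs) = invGo e (val v) ∷ invCs cs

  invGo : Expr → Expr → Val × Expr
  invGo (val v′) acc = v′ , acc
  invGo (elet p ω p′ e) acc = invGo e (elet p′ (inv ω) p acc)

-- Typing makes every iso well formed: each clause uses its variables linearly and, by
-- orthogonality, the left-hand values as well as the right-hand values of the clauses are
-- pairwise apart, so that no value matches two of them. For a well-formed ω, an evaluation of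
-- ω a to w runs the chosen clause body through a sequence of environments; linearity lets this
-- run be replayed backwards, and the backward replay is an evaluation of the inverted clause,
-- so ω⊥ w evaluates to a. Apartness makes evaluation deterministic. Now ω (ω⊥ v) ⟶* v′ splits
-- into ω⊥ v ⇓ u and ω u ⇓ v′; reversing the first evaluation (ω⊥⊥ = ω) gives ω u ⇓ v, so v′ = v.

module Submission where

open import Defs
open import Data.Nat using (ℕ; zero; suc; _≡ᵇ_; _≤_; s≤s; _⊔_; _≟_)
open import Data.Nat.Properties using (≤-trans; m≤m⊔n; m≤n⊔m; n≤1+n; ≡ᵇ⇒≡; ≡⇒≡ᵇ)
open import Data.Bool using (true; false; if_then_else_; _∨_; T)
open import Data.Maybe using (Maybe; just; nothing; maybe; maybe′; _<∣>_)
open import Data.Maybe.Properties using (<∣>-identityʳ)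
open import Data.List using (List; []; _∷_; [_]; _++_; map; concatMap)
open import Data.List.Relation.Unary.Any using (here; there)
open import Data.List.Relation.Unary.All as All using (All; []; _∷_)
open import Data.List.Relation.Unary.AllPairs as AllPairs using (AllPairs; []; _∷_)
import Data.List.Relation.Unary.AllPairs.Properties as AllPairsₚ
import Data.List.Relation.Unary.All.Properties as Allₚ
open import Data.List.Relation.Binary.Permutation.Propositional using (_↭_; ↭-sym; ↭⇒↭ₛ)
import Data.List.Relation.Binary.Permutation.Setoid.Properties as Permutationₛ
open import Data.List.Membership.Propositional using (_∈_; _∉_)
open import Data.List.Membership.DecPropositional _≟_ using (_∈?_)
open import Data.List.Membership.Propositional.Properties using (∈-++⁺ˡ; ∈-++⁺ʳ; ∈-++⁻)
open import Data.List.Relation.Binary.Disjoint.Propositional using (Disjoint)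
open import Data.List.Relation.Binary.Subset.Propositional {A = ℕ} using (_⊆_)
open import Data.List.Relation.Binary.Subset.Propositional.Properties
  using (⊆-trans; ⊆-reflexive-↭; ++⁺; xs⊆xs++ys; xs⊆ys++xs)
open import Data.List.Relation.Unary.Unique.Propositional using (Unique)
import Data.List.Relation.Binary.Permutation.Propositional.Properties as Permutationₚ
open import Data.List.Properties using (map-++)
open import Data.Product using (Σ; _×_; _,_; proj₁; proj₂)
open import Relation.Binary.Construct.Closure.ReflexiveTransitive using (ε; _◅_)
open import Data.Sum using (_⊎_; inj₁; inj₂; [_,_]′)
open import Data.Empty using (⊥; ⊥-elim)
open import Data.Unit using (⊤; tt)
open import Function using (_∘_; id)
open import Relation.Nullary using (yes; no; does)
open import Relation.Binary.PropositionalEquality hiding ([_])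
open ≡-Reasoning

++-⊆ : ∀ {xs ys zs : List ℕ} → xs ⊆ zs → ys ⊆ zs → xs ++ ys ⊆ zs
++-⊆ {xs} xs⊆zs ys⊆zs = [ xs⊆zs , ys⊆zs ]′ ∘ ∈-++⁻ xs

Unique-++⁻ : ∀ {A : Set} (xs : List A) {ys} → Unique (xs ++ ys) → Unique xs × Unique ys × Disjoint xs ys
Unique-++⁻ [] u = [] , u , λ ()
Unique-++⁻ (x ∷ xs) (x∉ ∷ u) =
  let uxs , uys , xs#ys = Unique-++⁻ xs u
  in Allₚ.++⁻ˡ xs x∉ ∷ uxs , uys ,
     λ { (here refl , x∈ys) → All.lookup x∉ (∈-++⁺ʳ xs x∈ys) refl ; (there y∈xs , y∈ys) → xs#ys (y∈xs , y∈ys) }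

AllPairs-∈ : ∀ {A : Set} {R : A → A → Set} {xs x y} → AllPairs R xs → x ∈ xs → y ∈ xs → x ≡ y ⊎ R x y ⊎ R y x
AllPairs-∈ (_ ∷ _) (here refl) (here refl) = inj₁ refl
AllPairs-∈ (Rx ∷ _) (here refl) (there y∈xs) = inj₂ (inj₁ (All.lookup Rx y∈xs))
AllPairs-∈ (Rx ∷ _) (there x∈xs) (here refl) = inj₂ (inj₂ (All.lookup Rx x∈xs))
AllPairs-∈ (_ ∷ Rxs) (there x∈xs) (there y∈xs) = AllPairs-∈ Rxs x∈xs y∈xs

-- Environments

≡ᵇ-refl : ∀ n → (n ≡ᵇ n) ≡ true
≡ᵇ-refl n with n ≡ᵇ n | ≡⇒≡ᵇ n n refl
... | true | _ = refl

≡ᵇ-true⇒≡ : ∀ m n → (m ≡ᵇ n) ≡ true → m ≡ n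
≡ᵇ-true⇒≡ m n e = ≡ᵇ⇒≡ m n (subst T (sym e) tt)

elemℕ≡does-∈? : ∀ x xs → elemℕ x xs ≡ does (x ∈? xs)
elemℕ≡does-∈? x [] = refl
elemℕ≡does-∈? x (y ∷ ys) = cong ((x ≡ᵇ y) ∨_) (elemℕ≡does-∈? x ys)

dec-∈ : ∀ x xs → x ∈ xs ⊎ x ∉ xs
dec-∈ x xs with x ∈? xs
... | yes x∈xs = inj₁ x∈xs
... | no x∉xs = inj₂ x∉xs

Env : Set
Env = ℕ → Maybe Val

infixr 6 _⊞_
infixl 7 _∖_ _↾_
infix 4 _⊑_

_⊞_ : Env → Env → Env
(ρ ⊞ ρ′) x = ρ x <∣> ρ′ x

_∖_ : Env → Env → Env
(ρ ∖ ρ′) x = maybe′ (λ _ → nothing) (ρ x) (ρ′ x)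

_↾_ : Env → List ℕ → Env
(ρ ↾ xs) x = if does (x ∈? xs) then ρ x else nothing

without : List ℕ → Env → Env
without xs ρ x = if does (x ∈? xs) then nothing else ρ x

_⊑_ : Env → Env → Set
ρ ⊑ ρ′ = ∀ x u → ρ x ≡ just u → ρ′ x ≡ just u

DisjointEnv : Env → Env → Set
DisjointEnv ρ ρ′ = ∀ x u → ρ x ≡ just u → ρ′ x ≡ nothing

ClosedEnv : Env → Set
ClosedEnv ρ = ∀ x u → ρ x ≡ just u → Closed u

DefinedOn : Env → List ℕ → Set
DefinedOn ρ xs = ∀ {x} → x ∈ xs → Σ Val λ u → ρ x ≡ just u

↾-∈ : ∀ ρ xs {x} → x ∈ xs → (ρ ↾ xs) x ≡ ρ x
↾-∈ ρ xs {x} x∈xs with x ∈? xs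
... | yes _ = refl
... | no x∉xs = ⊥-elim (x∉xs x∈xs)

↾-∉ : ∀ ρ xs {x} → x ∉ xs → (ρ ↾ xs) x ≡ nothing
↾-∉ ρ xs {x} x∉xs with x ∈? xs
... | yes x∈xs = ⊥-elim (x∉xs x∈xs)
... | no _ = refl

↾-just : ∀ ρ xs x {u} → (ρ ↾ xs) x ≡ just u → x ∈ xs × ρ x ≡ just u
↾-just ρ xs x e with x ∈? xs
... | yes x∈xs = x∈xs , e

↾-cong : ∀ ρ {xs ys} → xs ⊆ ys → ys ⊆ xs → ρ ↾ xs ≗ ρ ↾ ys
↾-cong ρ {xs} {ys} xs⊆ys ys⊆xs x with dec-∈ x xs
... | inj₁ x∈xs = trans (↾-∈ ρ xs x∈xs) (sym (↾-∈ ρ ys (xs⊆ys x∈xs)))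
... | inj₂ x∉xs = trans (↾-∉ ρ xs x∉xs) (sym (↾-∉ ρ ys (λ x∈ys → x∉xs (ys⊆xs x∈ys))))

without-∈ : ∀ xs ρ {x} → x ∈ xs → without xs ρ x ≡ nothing
without-∈ xs ρ {x} x∈xs with x ∈? xs
... | yes _ = refl
... | no x∉xs = ⊥-elim (x∉xs x∈xs)

without-∉ : ∀ xs ρ {x} → x ∉ xs → without xs ρ x ≡ ρ x
without-∉ xs ρ {x} x∉xs with x ∈? xs
... | yes x∈xs = ⊥-elim (x∉xs x∈xs)
... | no _ = refl

without-closed : ∀ xs {ρ} → ClosedEnv ρ → ClosedEnv (without xs ρ)
without-closed xs cl x u e with x ∈? xs
... | no _ = cl x u e

⊞-closed : ∀ {ρ ρ′} → ClosedEnv ρ → ClosedEnv ρ′ → ClosedEnv (ρ ⊞ ρ′)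
⊞-closed {ρ} cl cl′ x u e with ρ x in ρx
... | just v with refl ← e = cl x v ρx
... | nothing = cl′ x u e

∖-just : ∀ ρ ρ′ x {u} → (ρ ∖ ρ′) x ≡ just u → ρ x ≡ just u × ρ′ x ≡ nothing
∖-just ρ ρ′ x e with ρ′ x
... | nothing = e , refl

⊞-⊑ˡ : ∀ ρ ρ′ → ρ ⊑ (ρ ⊞ ρ′)
⊞-⊑ˡ ρ ρ′ x u ρx rewrite ρx = refl

↾-⊑ : ∀ ρ {xs ys} → xs ⊆ ys → ρ ↾ xs ⊑ ρ ↾ ys
↾-⊑ ρ {xs} {ys} xs⊆ys x u e with x∈xs , ρx ← ↾-just ρ xs x e = trans (↾-∈ ρ ys (xs⊆ys x∈xs)) ρx

⊞-congʳ : ∀ ρ {ρ′ ρ″} → ρ′ ≗ ρ″ → ρ ⊞ ρ′ ≗ ρ ⊞ ρ″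
⊞-congʳ ρ ρ′≗ρ″ x = cong (ρ x <∣>_) (ρ′≗ρ″ x)

∖-congˡ : ∀ {ρ ρ′} ρ″ → ρ ≗ ρ′ → ρ ∖ ρ″ ≗ ρ′ ∖ ρ″
∖-congˡ ρ″ ρ≗ρ′ x = cong (λ m → maybe′ (λ _ → nothing) m (ρ″ x)) (ρ≗ρ′ x)

∖-nothing : ∀ ρ ρ′ x → ρ x ≡ nothing → (ρ ∖ ρ′) x ≡ nothing
∖-nothing ρ ρ′ x ρx with ρ′ x
... | just _ = refl
... | nothing = ρx

⊑-trans : ∀ {ρ ρ′ ρ″} → ρ ⊑ ρ′ → ρ′ ⊑ ρ″ → ρ ⊑ ρ″
⊑-trans ρ⊑ρ′ ρ′⊑ρ″ x u e = ρ′⊑ρ″ x u (ρ⊑ρ′ x u e)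

↾-++ : ∀ ρ {xs ys} → DefinedOn ρ xs → (ρ ↾ xs) ⊞ (ρ ↾ ys) ≗ ρ ↾ (xs ++ ys)
↾-++ ρ {xs} {ys} def x with dec-∈ x xs
... | inj₁ x∈xs with u , ρx ← def x∈xs
  rewrite ↾-∈ ρ xs x∈xs | ↾-∈ ρ (xs ++ ys) (∈-++⁺ˡ {ys = ys} x∈xs) | ρx = refl
... | inj₂ x∉xs rewrite ↾-∉ ρ xs x∉xs with dec-∈ x ys
...   | inj₁ x∈ys rewrite ↾-∈ ρ ys x∈ys | ↾-∈ ρ (xs ++ ys) (∈-++⁺ʳ xs x∈ys) = refl
...   | inj₂ x∉ys rewrite ↾-∉ ρ ys x∉ys | ↾-∉ ρ (xs ++ ys) ([ x∉xs , x∉ys ]′ ∘ ∈-++⁻ xs) = refl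

↾-∖-consumed : ∀ ρ {α A S rest} → α ≗ ρ ↾ A → DefinedOn ρ A → S ⊆ A ++ rest → rest ⊆ S →
               Disjoint A rest → (ρ ↾ S) ∖ α ≗ ρ ↾ rest
↾-∖-consumed ρ {α} {A} {S} {rest} α≗ def S⊆A++rest rest⊆S A#rest x with dec-∈ x rest
... | inj₁ x∈rest
  rewrite α≗ x | ↾-∉ ρ A (λ x∈A → A#rest (x∈A , x∈rest))
        | ↾-∈ ρ S (rest⊆S x∈rest) | ↾-∈ ρ rest x∈rest = refl
... | inj₂ x∉rest rewrite ↾-∉ ρ rest x∉rest with dec-∈ x A
...   | inj₁ x∈A with u , ρx ← def x∈A rewrite α≗ x | ↾-∈ ρ A x∈A | ρx = refl
...   | inj₂ x∉A = ∖-nothing (ρ ↾ S) α x (↾-∉ ρ S ([ x∉A , x∉rest ]′ ∘ ∈-++⁻ A ∘ S⊆A++rest))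

HasDomain : Env → List ℕ → Set
HasDomain ρ xs = (∀ x u → ρ x ≡ just u → x ∈ xs) × DefinedOn ρ xs

HasDomain-∉ : ∀ {ρ xs x} → HasDomain ρ xs → x ∉ xs → ρ x ≡ nothing
HasDomain-∉ {ρ} {x = x} (dom⊆ , _) x∉xs with ρ x in ρx
... | just u = ⊥-elim (x∉xs (dom⊆ x u ρx))
... | nothing = refl

HasDomain-nothing⇒∉ : ∀ {ρ xs x} → HasDomain ρ xs → ρ x ≡ nothing → x ∉ xs
HasDomain-nothing⇒∉ (_ , def) ρx x∈xs with _ , ρx′ ← def x∈xs with () ← trans (sym ρx) ρx′

without-⊞-↾ : ∀ ρ {β B rest} → HasDomain β B → Disjoint B rest →
              (without B ρ ⊞ β) ↾ (B ++ rest) ≗ β ⊞ (ρ ↾ rest)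
without-⊞-↾ ρ {β} {B} {rest} hasDom B#rest x with dec-∈ x B
... | inj₁ x∈B with u , βx ← proj₂ hasDom x∈B
  rewrite ↾-∈ (without B ρ ⊞ β) (B ++ rest) (∈-++⁺ˡ {ys = rest} x∈B) | without-∈ B ρ x∈B | βx = refl
... | inj₂ x∉B with dec-∈ x rest
...   | inj₁ x∈rest
  rewrite ↾-∈ (without B ρ ⊞ β) (B ++ rest) (∈-++⁺ʳ B x∈rest) | without-∉ B ρ x∉B
        | HasDomain-∉ hasDom x∉B | <∣>-identityʳ (ρ x) | ↾-∈ ρ rest x∈rest = refl
...   | inj₂ x∉rest
  rewrite ↾-∉ (without B ρ ⊞ β) (B ++ rest) ([ x∉B , x∉rest ]′ ∘ ∈-++⁻ B)
        | HasDomain-∉ hasDom x∉B | ↾-∉ ρ rest x∉rest = refl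

without-⊞-definedOn : ∀ ρ {β B rest} → HasDomain β B → Disjoint B rest → DefinedOn ρ rest →
                      DefinedOn (without B ρ ⊞ β) (B ++ rest)
without-⊞-definedOn ρ {β} {B} hasDom B#rest def {x} x∈B++rest with ∈-++⁻ B x∈B++rest
... | inj₁ x∈B rewrite without-∈ B ρ x∈B = proj₂ hasDom x∈B
... | inj₂ x∈rest with u , ρx ← def x∈rest rewrite without-∉ B ρ (λ x∈B → B#rest (x∈B , x∈rest)) | ρx = u , refl

letStep : Env → Env → Env → Env
letStep α β ρ = β ⊞ (ρ ∖ α)

letStep-undo-disjoint : ∀ α β ρ → DisjointEnv α (letStep α β ρ ∖ β)
letStep-undo-disjoint α β ρ x u αx with β x
... | just _ = refl
... | nothing rewrite αx = refl

letStep-undo : ∀ α β ρ → α ⊑ ρ → DisjointEnv β (ρ ∖ α) → ρ ≗ α ⊞ (letStep α β ρ ∖ β)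
letStep-undo α β ρ α⊑ρ β#ρ∖α x with α x in αx
... | just u = α⊑ρ x u αx
... | nothing with β x in βx
...   | just t = trans (sym (cong (maybe′ (λ _ → nothing) (ρ x)) αx)) (β#ρ∖α x t βx)
...   | nothing = refl

letStep-⊑-without : ∀ {α β ρ ρ₁ xs} → HasDomain β xs → ρ ⊑ ρ₁ → letStep α β ρ ⊑ without xs ρ₁ ⊞ β
letStep-⊑-without {α} {β} {ρ} {ρ₁} {xs} hasDom ρ⊑ρ₁ x u e with β x in βx
... | just t rewrite without-∈ xs ρ₁ (proj₁ hasDom x t βx) = e
... | nothing with ρx , _ ← ∖-just ρ α x e
  rewrite without-∉ xs ρ₁ (HasDomain-nothing⇒∉ hasDom βx) | <∣>-identityʳ (ρ₁ x) = ρ⊑ρ₁ x u ρx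

≗↾-closed : ∀ {α} ρ xs → ClosedEnv ρ → α ≗ ρ ↾ xs → ClosedEnv α
≗↾-closed ρ xs cl α≗ x u αx = cl x u (proj₂ (↾-just ρ xs x (trans (sym (α≗ x)) αx)))

without-cong : ∀ xs {ρ ρ′} → ρ ≗ ρ′ → without xs ρ ≗ without xs ρ′
without-cong xs ρ≗ρ′ x = cong (if does (x ∈? xs) then nothing else_) (ρ≗ρ′ x)

without-⊞ : ∀ xs ρ ρ′ → without xs ρ ⊞ without xs ρ′ ≗ without xs (ρ ⊞ ρ′)
without-⊞ xs ρ ρ′ x with does (x ∈? xs)
... | true = refl
... | false = refl

lookupS-removeS-∈ : ∀ {xs x} σ → x ∈ xs → lookupS (removeS xs σ) x ≡ nothing
lookupS-removeS-∈ [] x∈xs = refl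
lookupS-removeS-∈ {xs} {x} ((y , v) ∷ σ) x∈xs rewrite elemℕ≡does-∈? y xs with y ∈? xs
... | yes _ = lookupS-removeS-∈ σ x∈xs
... | no y∉xs with x ≡ᵇ y in x≡ᵇy
...   | true = ⊥-elim (y∉xs (subst (_∈ xs) (≡ᵇ-true⇒≡ x y x≡ᵇy) x∈xs))
...   | false = lookupS-removeS-∈ σ x∈xs

lookupS-removeS-∉ : ∀ {xs x} σ → x ∉ xs → lookupS (removeS xs σ) x ≡ lookupS σ x
lookupS-removeS-∉ [] x∉xs = refl
lookupS-removeS-∉ {xs} {x} ((y , v) ∷ σ) x∉xs rewrite elemℕ≡does-∈? y xs with y ∈? xs
... | yes y∈xs with x ≡ᵇ y in x≡ᵇy
...   | true = ⊥-elim (x∉xs (subst (_∈ xs) (sym (≡ᵇ-true⇒≡ x y x≡ᵇy)) y∈xs))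
...   | false = lookupS-removeS-∉ σ x∉xs
lookupS-removeS-∉ {xs} {x} ((y , v) ∷ σ) x∉xs | no _ with x ≡ᵇ y
...   | true = refl
...   | false = lookupS-removeS-∉ σ x∉xs

lookupS-removeS : ∀ xs σ → lookupS (removeS xs σ) ≗ without xs (lookupS σ)
lookupS-removeS xs σ x with x ∈? xs
... | yes x∈xs = lookupS-removeS-∈ σ x∈xs
... | no x∉xs = lookupS-removeS-∉ σ x∉xs

substEnv : Env → Term → Term
substEnv ρ unit = unit
substEnv ρ (var x) = maybe′ valT (var x) (ρ x)
substEnv ρ (inl t) = inl (substEnv ρ t)
substEnv ρ (inr t) = inr (substEnv ρ t)
substEnv ρ (pair t u) = pair (substEnv ρ t) (substEnv ρ u)
substEnv ρ (fold t) = fold (substEnv ρ t)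
substEnv ρ (app ω t) = app ω (substEnv ρ t)
substEnv ρ (tlet p t u) = tlet p (substEnv ρ t) (substEnv (without (patVars p) ρ) u)

substEnv-cong : ∀ {ρ ρ′} t → ρ ≗ ρ′ → substEnv ρ t ≡ substEnv ρ′ t
substEnv-cong unit e = refl
substEnv-cong (var x) e = cong (maybe′ valT (var x)) (e x)
substEnv-cong (inl t) e = cong inl (substEnv-cong t e)
substEnv-cong (inr t) e = cong inr (substEnv-cong t e)
substEnv-cong (pair t u) e = cong₂ pair (substEnv-cong t e) (substEnv-cong u e)
substEnv-cong (fold t) e = cong fold (substEnv-cong t e)
substEnv-cong (app ω t) e = cong (app ω) (substEnv-cong t e)
substEnv-cong (tlet p t u) e =
  cong₂ (tlet p) (substEnv-cong t e) (substEnv-cong u (without-cong (patVars p) e))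

substT≡substEnv : ∀ σ t → substT σ t ≡ substEnv (lookupS σ) t
substT≡substEnv σ unit = refl
substT≡substEnv σ (var x) = refl
substT≡substEnv σ (inl t) = cong inl (substT≡substEnv σ t)
substT≡substEnv σ (inr t) = cong inr (substT≡substEnv σ t)
substT≡substEnv σ (pair t u) = cong₂ pair (substT≡substEnv σ t) (substT≡substEnv σ u)
substT≡substEnv σ (fold t) = cong fold (substT≡substEnv σ t)
substT≡substEnv σ (app ω t) = cong (app ω) (substT≡substEnv σ t)
substT≡substEnv σ (tlet p t u) =
  cong₂ (tlet p) (substT≡substEnv σ t)
    (trans (substT≡substEnv (removeS (patVars p) σ) u)
           (substEnv-cong u (lookupS-removeS (patVars p) σ)))

substEnv-closed : ∀ ρ v → Closed v → substEnv ρ (valT v) ≡ valT v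
substEnv-closed ρ unit c = refl
substEnv-closed ρ (inl v) c = cong inl (substEnv-closed ρ v c)
substEnv-closed ρ (inr v) c = cong inr (substEnv-closed ρ v c)
substEnv-closed ρ (pair v w) (c , d) = cong₂ pair (substEnv-closed ρ v c) (substEnv-closed ρ w d)
substEnv-closed ρ (fold v) c = cong fold (substEnv-closed ρ v c)

substEnv-∘ : ∀ ρ ρ′ t → ClosedEnv ρ′ → substEnv ρ (substEnv ρ′ t) ≡ substEnv (ρ′ ⊞ ρ) t
substEnv-∘ ρ ρ′ unit cl = refl
substEnv-∘ ρ ρ′ (var x) cl with ρ′ x in ρ′x
... | just v = substEnv-closed ρ v (cl x v ρ′x)
... | nothing = refl
substEnv-∘ ρ ρ′ (inl t) cl = cong inl (substEnv-∘ ρ ρ′ t cl)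
substEnv-∘ ρ ρ′ (inr t) cl = cong inr (substEnv-∘ ρ ρ′ t cl)
substEnv-∘ ρ ρ′ (pair t u) cl = cong₂ pair (substEnv-∘ ρ ρ′ t cl) (substEnv-∘ ρ ρ′ u cl)
substEnv-∘ ρ ρ′ (fold t) cl = cong fold (substEnv-∘ ρ ρ′ t cl)
substEnv-∘ ρ ρ′ (app ω t) cl = cong (app ω) (substEnv-∘ ρ ρ′ t cl)
substEnv-∘ ρ ρ′ (tlet p t u) cl =
  cong₂ (tlet p) (substEnv-∘ ρ ρ′ t cl)
    (trans (substEnv-∘ (without xs ρ) (without xs ρ′) u (without-closed xs cl))
           (substEnv-cong u (without-⊞ xs ρ′ ρ)))
  where xs = patVars p

substT-substEnv : ∀ τ {ρ} t → ClosedEnv ρ → substT τ (substEnv ρ t) ≡ substEnv (ρ ⊞ lookupS τ) t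
substT-substEnv τ {ρ} t cl = trans (substT≡substEnv τ (substEnv ρ t)) (substEnv-∘ (lookupS τ) ρ t cl)

-- Big-step evaluation

-- The index bounds the nesting of iso calls; it is the termination measure of Eval⇒Run,
-- whose recursive calls are on substituted terms.
mutual
  data Eval : ℕ → Term → Val → Set where
    ev-unit : ∀ {n} → Eval n unit unit
    ev-var  : ∀ {n x} → Eval n (var x) (var x)
    ev-inl  : ∀ {n t v} → Eval n t v → Eval n (inl t) (inl v)
    ev-inr  : ∀ {n t v} → Eval n t v → Eval n (inr t) (inr v)
    ev-fold : ∀ {n t v} → Eval n t v → Eval n (fold t) (fold v)
    ev-pair : ∀ {n t u v w} → Eval n t v → Eval n u w → Eval n (pair t u) (pair v w)
    ev-app  : ∀ {n ω t a w} → Eval n t a → EvalIso n ω a w → Eval (suc n) (app ω t) w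
    ev-let  : ∀ {n p t u a σ w} → Eval n t a → Match σ (patVal p) a → Eval n (substT σ u) w →
              Eval (suc n) (tlet p t u) w

  data EvalIso : ℕ → Iso → Val → Val → Set where
    ev-clause : ∀ {n cs v e σ a w} → (v , e) ∈ cs → Match σ v a →
                Eval n (substT σ (toTerm e)) w → EvalIso (suc n) (clauses cs) a w
    ev-fix    : ∀ {n f ω a w} → EvalIso n (substI f (fix f ω) ω) a w → EvalIso (suc n) (fix f ω) a w

mutual
  Eval-mono : ∀ {n m t v} → n ≤ m → Eval n t v → Eval m t v
  Eval-mono le ev-unit = ev-unit
  Eval-mono le ev-var = ev-var
  Eval-mono le (ev-inl d) = ev-inl (Eval-mono le d)
  Eval-mono le (ev-inr d) = ev-inr (Eval-mono le d)
  Eval-mono le (ev-fold d) = ev-fold (Eval-mono le d)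
  Eval-mono le (ev-pair d e) = ev-pair (Eval-mono le d) (Eval-mono le e)
  Eval-mono (s≤s le) (ev-app d i) = ev-app (Eval-mono le d) (EvalIso-mono le i)
  Eval-mono (s≤s le) (ev-let d m e) = ev-let (Eval-mono le d) m (Eval-mono le e)

  EvalIso-mono : ∀ {n m ω a w} → n ≤ m → EvalIso n ω a w → EvalIso m ω a w
  EvalIso-mono (s≤s le) (ev-clause mem m d) = ev-clause mem m (Eval-mono le d)
  EvalIso-mono (s≤s le) (ev-fix i) = ev-fix (EvalIso-mono le i)

Eval-valT : ∀ n v → Eval n (valT v) v
Eval-valT n unit = ev-unit
Eval-valT n (var x) = ev-var
Eval-valT n (inl v) = ev-inl (Eval-valT n v)
Eval-valT n (inr v) = ev-inr (Eval-valT n v)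
Eval-valT n (pair v w) = ev-pair (Eval-valT n v) (Eval-valT n w)
Eval-valT n (fold v) = ev-fold (Eval-valT n v)

Eval-valT-inv : ∀ {n} v {u} → Eval n (valT v) u → u ≡ v
Eval-valT-inv unit ev-unit = refl
Eval-valT-inv (var x) ev-var = refl
Eval-valT-inv (inl v) (ev-inl d) = cong inl (Eval-valT-inv v d)
Eval-valT-inv (inr v) (ev-inr d) = cong inr (Eval-valT-inv v d)
Eval-valT-inv (pair v w) (ev-pair d e) = cong₂ pair (Eval-valT-inv v d) (Eval-valT-inv w e)
Eval-valT-inv (fold v) (ev-fold d) = cong fold (Eval-valT-inv v d)

Eval-expand : ∀ {t t′ n v} → t ⟶ t′ → Eval n t′ v → Σ ℕ λ m → Eval m t v
Eval-expand (r-inl s) (ev-inl d) with m , d′ ← Eval-expand s d = m , ev-inl d′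
Eval-expand (r-inr s) (ev-inr d) with m , d′ ← Eval-expand s d = m , ev-inr d′
Eval-expand (r-fold s) (ev-fold d) with m , d′ ← Eval-expand s d = m , ev-fold d′
Eval-expand {n = n} (r-pairˡ s) (ev-pair d e) with m , d′ ← Eval-expand s d =
  m ⊔ n , ev-pair (Eval-mono (m≤m⊔n m n) d′) (Eval-mono (m≤n⊔m m n) e)
Eval-expand {n = n} (r-pairʳ s) (ev-pair d e) with m , e′ ← Eval-expand s e =
  m ⊔ n , ev-pair (Eval-mono (m≤n⊔m m n) d) (Eval-mono (m≤m⊔n m n) e′)
Eval-expand (r-arg s) (ev-app {n = n} d i) with m , d′ ← Eval-expand s d =
  suc (m ⊔ n) , ev-app (Eval-mono (m≤m⊔n m n) d′) (EvalIso-mono (m≤n⊔m m n) i)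
Eval-expand (r-let s) (ev-let {n = n} d mt e) with m , d′ ← Eval-expand s d =
  suc (m ⊔ n) , ev-let (Eval-mono (m≤m⊔n m n) d′) mt (Eval-mono (m≤n⊔m m n) e)
Eval-expand (r-iso fix-unfold) (ev-app {n = n} d i) =
  suc (suc n) , ev-app (Eval-mono (n≤1+n n) d) (ev-fix i)
Eval-expand {n = n} (r-letβ {v = v} mt) d = suc n , ev-let (Eval-valT n v) mt d
Eval-expand {n = n} (r-clause {w = w} mem mt) d =
  suc (suc n) , ev-app (Eval-valT (suc n) w) (ev-clause mem mt d)

⟶*⇒Eval : ∀ {t v} → t ⟶* valT v → Σ ℕ λ n → Eval n t v
⟶*⇒Eval {v = v} ε = 0 , Eval-valT 0 v
⟶*⇒Eval (s ◅ ss) with n , d ← ⟶*⇒Eval ss = Eval-expand s d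

Eval-letApp : ∀ {m₁ m₂ p ω t u a w τ v} → Eval m₁ t a → EvalIso m₁ ω a w → Match τ (patVal p) w →
              Eval m₂ (substT τ u) v → Eval (suc (suc (m₁ ⊔ m₂))) (tlet p (app ω t) u) v
Eval-letApp {m₁} {m₂} d i mτ d′ =
  ev-let (ev-app (Eval-mono (m≤m⊔n m₁ m₂) d) (EvalIso-mono (m≤m⊔n m₁ m₂) i)) mτ
         (Eval-mono (≤-trans (m≤n⊔m m₁ m₂) (n≤1+n _)) d′)

vars : Val → List ℕ
vars unit = []
vars (var x) = [ x ]
vars (inl v) = vars v
vars (inr v) = vars v
vars (pair v w) = vars v ++ vars w
vars (fold v) = vars v

vars-patVal : ∀ p → vars (patVal p) ≡ patVars p
vars-patVal (pvar x) = refl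
vars-patVal (ppair p q) = cong₂ _++_ (vars-patVal p) (vars-patVal q)

∈-vars-patVal : ∀ p {x} → x ∈ vars (patVal p) → x ∈ patVars p
∈-vars-patVal p {x} = subst (x ∈_) (vars-patVal p)

∈-patVars : ∀ p {x} → x ∈ patVars p → x ∈ vars (patVal p)
∈-patVars p {x} = subst (x ∈_) (sym (vars-patVal p))

lookupS-++ : ∀ σ₁ σ₂ → lookupS (σ₁ ++ σ₂) ≗ lookupS σ₁ ⊞ lookupS σ₂
lookupS-++ [] σ₂ x = refl
lookupS-++ ((y , v) ∷ σ₁) σ₂ x with x ≡ᵇ y
... | true = refl
... | false = lookupS-++ σ₁ σ₂ x

lookupS-just⇒∈dom : ∀ σ x {u} → lookupS σ x ≡ just u → x ∈ dom σ
lookupS-just⇒∈dom ((y , v) ∷ σ) x e with x ≡ᵇ y in x≡ᵇy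
... | true = here (≡ᵇ-true⇒≡ x y x≡ᵇy)
... | false = there (lookupS-just⇒∈dom σ x e)

∈dom⇒lookupS-just : ∀ σ {x} → x ∈ dom σ → Σ Val λ u → lookupS σ x ≡ just u
∈dom⇒lookupS-just ((y , v) ∷ σ) {x} (here refl) rewrite ≡ᵇ-refl x = v , refl
∈dom⇒lookupS-just ((y , v) ∷ σ) {x} (there x∈σ) with x ≡ᵇ y
... | true = v , refl
... | false = ∈dom⇒lookupS-just σ x∈σ

lookupS-++⁺ˡ : ∀ σ₁ σ₂ x {u} → lookupS σ₁ x ≡ just u → lookupS (σ₁ ++ σ₂) x ≡ just u
lookupS-++⁺ˡ σ₁ σ₂ x e rewrite lookupS-++ σ₁ σ₂ x | e = refl

lookupS-++⁺ʳ : ∀ σ₁ σ₂ x {u} → Disjoint (dom σ₁) (dom σ₂) → lookupS σ₂ x ≡ just u →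
               lookupS (σ₁ ++ σ₂) x ≡ just u
lookupS-++⁺ʳ σ₁ σ₂ x dj e rewrite lookupS-++ σ₁ σ₂ x with lookupS σ₁ x in σ₁x
... | just _ = ⊥-elim (dj (lookupS-just⇒∈dom σ₁ x σ₁x , lookupS-just⇒∈dom σ₂ x e))
... | nothing = e

lookupS-singleton : ∀ x w y {u} → lookupS [ (x , w) ] y ≡ just u → y ≡ x × u ≡ w
lookupS-singleton x w y e with y ≡ᵇ x in y≡ᵇx
lookupS-singleton x w y refl | true = ≡ᵇ-true⇒≡ y x y≡ᵇx , refl

match-lookup⇒∈vars : ∀ {σ v w x u} → Match σ v w → lookupS σ x ≡ just u → x ∈ vars v
match-lookup⇒∈vars {x = x} (m-var {y} {w}) e with refl , _ ← lookupS-singleton y w x e = here refl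
match-lookup⇒∈vars (m-inl m) e = match-lookup⇒∈vars m e
match-lookup⇒∈vars (m-inr m) e = match-lookup⇒∈vars m e
match-lookup⇒∈vars (m-fold m) e = match-lookup⇒∈vars m e
match-lookup⇒∈vars {x = x} (m-pair {σ₁} {σ₂} {v₁} m₁ m₂ _) e
  rewrite lookupS-++ σ₁ σ₂ x with lookupS σ₁ x in σ₁x
... | just _ = ∈-++⁺ˡ (match-lookup⇒∈vars m₁ σ₁x)
... | nothing = ∈-++⁺ʳ (vars v₁) (match-lookup⇒∈vars m₂ e)

match-definedOn : ∀ {σ v w} → Match σ v w → DefinedOn (lookupS σ) (vars v)
match-definedOn (m-var {x} {w}) (here refl) rewrite ≡ᵇ-refl x = w , refl
match-definedOn (m-inl m) = match-definedOn m
match-definedOn (m-inr m) = match-definedOn m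
match-definedOn (m-fold m) = match-definedOn m
match-definedOn (m-pair {σ₁} {σ₂} {v₁} m₁ m₂ _) {x} x∈v
  rewrite lookupS-++ σ₁ σ₂ x with ∈-++⁻ (vars v₁) x∈v
... | inj₁ x∈v₁ with u , e ← match-definedOn m₁ x∈v₁ rewrite e = u , refl
... | inj₂ x∈v₂ with lookupS σ₁ x
...   | just u = u , refl
...   | nothing = match-definedOn m₂ x∈v₂

match-closedEnv : ∀ {σ v w} → Match σ v w → Closed w → ClosedEnv (lookupS σ)
match-closedEnv (m-var {x} {w}) c y u e with _ , refl ← lookupS-singleton x w y e = c
match-closedEnv (m-inl m) c = match-closedEnv m c
match-closedEnv (m-inr m) c = match-closedEnv m c
match-closedEnv (m-fold m) c = match-closedEnv m c
match-closedEnv (m-pair {σ₁} {σ₂} m₁ m₂ _) (c₁ , c₂) y u e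
  rewrite lookupS-++ σ₁ σ₂ y with lookupS σ₁ y in σ₁y
... | just _ = match-closedEnv m₁ c₁ y u (trans σ₁y e)
... | nothing = match-closedEnv m₂ c₂ y u e

match-closed : ∀ {σ v w} → Match σ v w → ClosedEnv (lookupS σ) → Closed w
match-closed {v = var x} (m-var {w = w}) cl = cl x w (cong (if_then just w else nothing) (≡ᵇ-refl x))
match-closed m-unit cl = tt
match-closed (m-inl m) cl = match-closed m cl
match-closed (m-inr m) cl = match-closed m cl
match-closed (m-fold m) cl = match-closed m cl
match-closed (m-pair {σ₁} {σ₂} m₁ m₂ dj) cl =
  match-closed m₁ (λ x u e → cl x u (lookupS-++⁺ˡ σ₁ σ₂ x e)) ,
  match-closed m₂ (λ x u e → cl x u (lookupS-++⁺ʳ σ₁ σ₂ x dj e))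

match-substEnv : ∀ {σ v w} ρ → Match σ v w → lookupS σ ⊑ ρ → substEnv ρ (valT v) ≡ valT w
match-substEnv {v = var x} ρ (m-var {w = w}) σ⊑ρ
  rewrite σ⊑ρ x w (cong (if_then just w else nothing) (≡ᵇ-refl x)) = refl
match-substEnv ρ m-unit σ⊑ρ = refl
match-substEnv ρ (m-inl m) σ⊑ρ = cong inl (match-substEnv ρ m σ⊑ρ)
match-substEnv ρ (m-inr m) σ⊑ρ = cong inr (match-substEnv ρ m σ⊑ρ)
match-substEnv ρ (m-fold m) σ⊑ρ = cong fold (match-substEnv ρ m σ⊑ρ)
match-substEnv ρ (m-pair {σ₁} {σ₂} m₁ m₂ dj) σ⊑ρ =
  cong₂ pair (match-substEnv ρ m₁ (λ x u e → σ⊑ρ x u (lookupS-++⁺ˡ σ₁ σ₂ x e)))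
             (match-substEnv ρ m₂ (λ x u e → σ⊑ρ x u (lookupS-++⁺ʳ σ₁ σ₂ x dj e)))

match-unique : ∀ {σ σ′ v w} → Match σ v w → Match σ′ v w → σ ≡ σ′
match-unique m-var m-var = refl
match-unique m-unit m-unit = refl
match-unique (m-inl m) (m-inl m′) = match-unique m m′
match-unique (m-inr m) (m-inr m′) = match-unique m m′
match-unique (m-fold m) (m-fold m′) = match-unique m m′
match-unique (m-pair m₁ m₂ _) (m-pair m₁′ m₂′ _) = cong₂ _++_ (match-unique m₁ m₁′) (match-unique m₂ m₂′)

≗↾-∈dom : ∀ {σ ρ xs x} → lookupS σ ≗ ρ ↾ xs → x ∈ dom σ → x ∈ xs
≗↾-∈dom {σ} {ρ} {xs} {x} σ≗ x∈σ with u , σx ← ∈dom⇒lookupS-just σ x∈σ =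
  proj₁ (↾-just ρ xs x (trans (sym (σ≗ x)) σx))

match-hasDomain : ∀ {σ v w} → Match σ v w → HasDomain (lookupS σ) (vars v)
match-hasDomain m = (λ x u → match-lookup⇒∈vars m) , match-definedOn m

match-hasDomain-pat : ∀ p {σ w} → Match σ (patVal p) w → HasDomain (lookupS σ) (patVars p)
match-hasDomain-pat p m = subst (HasDomain _) (vars-patVal p) (match-hasDomain m)

match-≗↾ : ∀ {σ v w} → Match σ v w → lookupS σ ≗ lookupS σ ↾ vars v
match-≗↾ {σ} {v} m x with dec-∈ x (vars v)
... | inj₁ x∈v = sym (↾-∈ (lookupS σ) (vars v) x∈v)
... | inj₂ x∉v = trans (HasDomain-∉ (match-hasDomain m) x∉v) (sym (↾-∉ (lookupS σ) (vars v) x∉v))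

-- Orthogonality

data Apart : Val → Val → Set where
  inl-inr : ∀ {v w} → Apart (inl v) (inr w)
  inr-inl : ∀ {v w} → Apart (inr v) (inl w)
  inl     : ∀ {v w} → Apart v w → Apart (inl v) (inl w)
  inr     : ∀ {v w} → Apart v w → Apart (inr v) (inr w)
  fold    : ∀ {v w} → Apart v w → Apart (fold v) (fold w)
  pairˡ   : ∀ {v₁ v₂ w₁ w₂} → Apart v₁ w₁ → Apart (pair v₁ v₂) (pair w₁ w₂)
  pairʳ   : ∀ {v₁ v₂ w₁ w₂} → Apart v₂ w₂ → Apart (pair v₁ v₂) (pair w₁ w₂)

Apart-sym : ∀ {v w} → Apart v w → Apart w v
Apart-sym inl-inr = inr-inl
Apart-sym inr-inl = inl-inr
Apart-sym (inl a) = inl (Apart-sym a)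
Apart-sym (inr a) = inr (Apart-sym a)
Apart-sym (fold a) = fold (Apart-sym a)
Apart-sym (pairˡ a) = pairˡ (Apart-sym a)
Apart-sym (pairʳ a) = pairʳ (Apart-sym a)

Apart⇒¬matchBoth : ∀ {v v′ σ σ′ w} → Apart v v′ → Match σ v w → Match σ′ v′ w → ⊥
Apart⇒¬matchBoth inl-inr (m-inl _) ()
Apart⇒¬matchBoth inr-inl (m-inr _) ()
Apart⇒¬matchBoth (inl a) (m-inl m) (m-inl m′) = Apart⇒¬matchBoth a m m′
Apart⇒¬matchBoth (inr a) (m-inr m) (m-inr m′) = Apart⇒¬matchBoth a m m′
Apart⇒¬matchBoth (fold a) (m-fold m) (m-fold m′) = Apart⇒¬matchBoth a m m′
Apart⇒¬matchBoth (pairˡ a) (m-pair m _ _) (m-pair m′ _ _) = Apart⇒¬matchBoth a m m′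
Apart⇒¬matchBoth (pairʳ a) (m-pair _ m _) (m-pair _ m′ _) = Apart⇒¬matchBoth a m m′

AllPairs-Apart-resp-↭ : ∀ {S S′} → S ↭ S′ → AllPairs Apart S → AllPairs Apart S′
AllPairs-Apart-resp-↭ S↭S′ =
  Permutationₛ.AllPairs-resp-↭ (setoid Val) Apart-sym (resp₂ Apart) (↭⇒↭ₛ S↭S′)

AllPairs-Apart-blocks : (f : Val → Val → Val) →
  (∀ {k k′ w w′} → Apart k k′ → Apart (f k w) (f k′ w′)) →
  (∀ {k w w′} → Apart w w′ → Apart (f k w) (f k w′)) →
  ∀ KF → AllPairs Apart (map proj₁ KF) → All (λ kw → AllPairs Apart (proj₂ kw)) KF →
  AllPairs Apart (concatMap (λ kw → map (f (proj₁ kw)) (proj₂ kw)) KF)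
AllPairs-Apart-blocks f keysApart fibresApart KF keys fibres =
  AllPairsₚ.concat⁺
    (Allₚ.map⁺ (All.map (λ ap → AllPairsₚ.map⁺ (AllPairs.map fibresApart ap)) fibres))
    (AllPairsₚ.map⁺ (AllPairs.map blockApart (AllPairsₚ.map⁻ keys)))
  where
  blockApart : ∀ {kw kw′} → Apart (proj₁ kw) (proj₁ kw′) →
               All (λ x → All (Apart x) (map (f (proj₁ kw′)) (proj₂ kw′))) (map (f (proj₁ kw)) (proj₂ kw))
  blockApart a = Allₚ.map⁺ (All.universal (λ _ → Allₚ.map⁺ (All.universal (λ _ → keysApart a) _)) _)

mutual
  OD⇒AllPairs-Apart : ∀ {A S} → OD A S → AllPairs Apart S
  OD⇒AllPairs-Apart od-var = [] ∷ []
  OD⇒AllPairs-Apart od-unit = [] ∷ []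
  OD⇒AllPairs-Apart (od-sum {S₁ = S₁} {S₂} perm o₁ o₂) =
    AllPairs-Apart-resp-↭ (↭-sym perm)
      (AllPairsₚ.++⁺ (AllPairsₚ.map⁺ (AllPairs.map inl (OD⇒AllPairs-Apart o₁)))
                     (AllPairsₚ.map⁺ (AllPairs.map inr (OD⇒AllPairs-Apart o₂)))
                     (Allₚ.map⁺ (All.universal (λ _ → Allₚ.map⁺ (All.universal (λ _ → inl-inr) S₂)) S₁)))
  OD⇒AllPairs-Apart (od-fold o) = AllPairsₚ.map⁺ (AllPairs.map fold (OD⇒AllPairs-Apart o))
  OD⇒AllPairs-Apart (od-pairL KF perm oK oF) =
    AllPairs-Apart-resp-↭ (↭-sym perm)
      (AllPairs-Apart-blocks pair pairˡ pairʳ KF (OD⇒AllPairs-Apart oK) (OD⇒AllPairs-Apart-fibres oF))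
  OD⇒AllPairs-Apart (od-pairR KF perm oK oF) =
    AllPairs-Apart-resp-↭ (↭-sym perm)
      (AllPairs-Apart-blocks (λ k w → pair w k) pairʳ pairˡ KF (OD⇒AllPairs-Apart oK) (OD⇒AllPairs-Apart-fibres oF))

  OD⇒AllPairs-Apart-fibres : ∀ {B KF} → All (λ kw → OD B (proj₂ kw)) KF → All (λ kw → AllPairs Apart (proj₂ kw)) KF
  OD⇒AllPairs-Apart-fibres [] = []
  OD⇒AllPairs-Apart-fibres (o ∷ os) = OD⇒AllPairs-Apart o ∷ OD⇒AllPairs-Apart-fibres os

-- Linearity and well-formed isos

Linear : Val → Set
Linear unit = ⊤
Linear (var x) = ⊤
Linear (inl v) = Linear v
Linear (inr v) = Linear v
Linear (pair v w) = Linear v × Linear w × Disjoint (vars v) (vars w)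
Linear (fold v) = Linear v

-- The scope discipline of  let p = ω p′ in e  in scope S: the call consumes the variables of p′,
-- and e is in scope patVars p ++ rest.
record LinearLet (S : List ℕ) (p p′ : Pat) (rest : List ℕ) : Set where
  field
    arg-linear   : Linear (patVal p′)
    bound-linear : Linear (patVal p)
    S⊆arg++rest  : S ⊆ patVars p′ ++ rest
    arg⊆S        : patVars p′ ⊆ S
    rest⊆S       : rest ⊆ S
    arg#rest     : Disjoint (patVars p′) rest
    bound#rest   : Disjoint (patVars p) rest

LinearIn : List ℕ → Expr → Set
LinearIn S (val v) = Linear v × S ⊆ vars v × vars v ⊆ S
LinearIn S (elet p ω p′ e) = Σ (List ℕ) λ rest → LinearLet S p p′ rest × LinearIn (patVars p ++ rest) e

LinearIn-resp : ∀ {S S′} e → S ⊆ S′ → S′ ⊆ S → LinearIn S e → LinearIn S′ e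
LinearIn-resp (val v) S⊆S′ S′⊆S (lin , S⊆v , v⊆S) = lin , S⊆v ∘ S′⊆S , S⊆S′ ∘ v⊆S
LinearIn-resp (elet p ω p′ e) S⊆S′ S′⊆S (rest , ll , lin) = rest , ll′ , lin
  where
  open LinearLet ll
  ll′ : LinearLet _ p p′ rest
  ll′ = record { arg-linear = arg-linear ; bound-linear = bound-linear
               ; S⊆arg++rest = S⊆arg++rest ∘ S′⊆S ; arg⊆S = S⊆S′ ∘ arg⊆S ; rest⊆S = S⊆S′ ∘ rest⊆S
               ; arg#rest = arg#rest ; bound#rest = bound#rest }

rhsVals : List (Val × Expr) → List Val
rhsVals = map (λ c → valOf (proj₂ c))

mutual
  WfIso : Iso → Set
  WfIso (clauses cs) = WfClauses cs × AllPairs Apart (map proj₁ cs) × AllPairs Apart (rhsVals cs)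
  WfIso (fix f ω) = WfIso ω
  WfIso (ivar f) = ⊤

  WfClauses : List (Val × Expr) → Set
  WfClauses [] = ⊤
  WfClauses ((v , e) ∷ cs) = (Linear v × LinearIn (vars v) e × WfExpr e) × WfClauses cs

  WfExpr : Expr → Set
  WfExpr (val v) = ⊤
  WfExpr (elet p ω p′ e) = WfIso ω × WfExpr e

WfClauses-∈ : ∀ {cs v e} → WfClauses cs → (v , e) ∈ cs → Linear v × LinearIn (vars v) e × WfExpr e
WfClauses-∈ (wf , _) (here refl) = wf
WfClauses-∈ (_ , wfs) (there c∈cs) = WfClauses-∈ wfs c∈cs

valOf-substE : ∀ f ω′ e → valOf (substE f ω′ e) ≡ valOf e
valOf-substE f ω′ (val v) = refl
valOf-substE f ω′ (elet p ω p′ e) = valOf-substE f ω′ e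

map-proj₁-substCs : ∀ f ω′ cs → map proj₁ (substCs f ω′ cs) ≡ map proj₁ cs
map-proj₁-substCs f ω′ [] = refl
map-proj₁-substCs f ω′ ((v , e) ∷ cs) = cong (v ∷_) (map-proj₁-substCs f ω′ cs)

rhsVals-substCs : ∀ f ω′ cs → rhsVals (substCs f ω′ cs) ≡ rhsVals cs
rhsVals-substCs f ω′ [] = refl
rhsVals-substCs f ω′ ((v , e) ∷ cs) = cong₂ _∷_ (valOf-substE f ω′ e) (rhsVals-substCs f ω′ cs)

LinearIn-substE : ∀ f {ω′ S} e → LinearIn S e → LinearIn S (substE f ω′ e)
LinearIn-substE f (val v) lin = lin
LinearIn-substE f (elet p ω p′ e) (rest , ll , lin) = rest , ll , LinearIn-substE f e lin

mutual
  WfIso-substI : ∀ f {ω′} ω → WfIso ω′ → WfIso ω → WfIso (substI f ω′ ω)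
  WfIso-substI f {ω′} (clauses cs) wf′ (wfs , lhs , rhs) =
    WfClauses-substCs f cs wf′ wfs ,
    subst (AllPairs Apart) (sym (map-proj₁-substCs f ω′ cs)) lhs ,
    subst (AllPairs Apart) (sym (rhsVals-substCs f ω′ cs)) rhs
  WfIso-substI f (fix g ω) wf′ wf with f ≡ᵇ g
  ... | true = wf
  ... | false = WfIso-substI f ω wf′ wf
  WfIso-substI f (ivar g) wf′ _ with f ≡ᵇ g
  ... | true = wf′
  ... | false = tt

  WfClauses-substCs : ∀ f {ω′} cs → WfIso ω′ → WfClauses cs → WfClauses (substCs f ω′ cs)
  WfClauses-substCs f [] wf′ tt = tt
  WfClauses-substCs f ((v , e) ∷ cs) wf′ ((lin-v , lin-e , wf-e) , wfs) =
    (lin-v , LinearIn-substE f e lin-e , WfExpr-substE f e wf′ wf-e) , WfClauses-substCs f cs wf′ wfs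

  WfExpr-substE : ∀ f {ω′} e → WfIso ω′ → WfExpr e → WfExpr (substE f ω′ e)
  WfExpr-substE f (val v) wf′ tt = tt
  WfExpr-substE f (elet p ω p′ e) wf′ (wf-ω , wf-e) = WfIso-substI f ω wf′ wf-ω , WfExpr-substE f e wf′ wf-e

WfIso-unfold : ∀ f ω → WfIso ω → WfIso (substI f (fix f ω) ω)
WfIso-unfold f ω wf = WfIso-substI f ω wf wf

-- Inversion

mutual
  inv-substI : ∀ f ω′ ω → inv (substI f ω′ ω) ≡ substI f (inv ω′) (inv ω)
  inv-substI f ω′ (clauses cs) = cong clauses (invCs-substCs f ω′ cs)
  inv-substI f ω′ (fix g ω) with f ≡ᵇ g
  ... | true = refl
  ... | false = cong (fix g) (inv-substI f ω′ ω)
  inv-substI f ω′ (ivar g) with f ≡ᵇ g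
  ... | true = refl
  ... | false = refl

  invCs-substCs : ∀ f ω′ cs → invCs (substCs f ω′ cs) ≡ substCs f (inv ω′) (invCs cs)
  invCs-substCs f ω′ [] = refl
  invCs-substCs f ω′ ((v , e) ∷ cs) = cong₂ _∷_ (invGo-substE f ω′ e (val v)) (invCs-substCs f ω′ cs)

  invGo-substE : ∀ f ω′ e acc →
    invGo (substE f ω′ e) (substE f (inv ω′) acc) ≡ (proj₁ (invGo e acc) , substE f (inv ω′) (proj₂ (invGo e acc)))
  invGo-substE f ω′ (val v) acc = refl
  invGo-substE f ω′ (elet p ω p′ e) acc
    rewrite inv-substI f ω′ ω = invGo-substE f ω′ e (elet p′ (inv ω) p acc)

proj₁-invGo : ∀ e acc → proj₁ (invGo e acc) ≡ valOf e
proj₁-invGo (val v) acc = refl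
proj₁-invGo (elet p ω p′ e) acc = proj₁-invGo e _

valOf-invGo : ∀ e acc → valOf (proj₂ (invGo e acc)) ≡ valOf acc
valOf-invGo (val v) acc = refl
valOf-invGo (elet p ω p′ e) acc = valOf-invGo e _

map-proj₁-invCs : ∀ cs → map proj₁ (invCs cs) ≡ rhsVals cs
map-proj₁-invCs [] = refl
map-proj₁-invCs ((v , e) ∷ cs) = cong₂ _∷_ (proj₁-invGo e (val v)) (map-proj₁-invCs cs)

rhsVals-invCs : ∀ cs → rhsVals (invCs cs) ≡ map proj₁ cs
rhsVals-invCs [] = refl
rhsVals-invCs ((v , e) ∷ cs) = cong₂ _∷_ (valOf-invGo e (val v)) (rhsVals-invCs cs)

invCs-∈ : ∀ {cs v e} → (v , e) ∈ cs → invGo e (val v) ∈ invCs cs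
invCs-∈ (here refl) = here refl
invCs-∈ (there c∈cs) = there (invCs-∈ c∈cs)

LinearLet-reverse : ∀ {S p p′ rest} → LinearLet S p p′ rest → LinearLet (patVars p ++ rest) p′ p rest
LinearLet-reverse {p = p} ll = record
  { arg-linear = bound-linear ; bound-linear = arg-linear
  ; S⊆arg++rest = λ x∈ → x∈ ; arg⊆S = ∈-++⁺ˡ ; rest⊆S = ∈-++⁺ʳ (patVars p)
  ; arg#rest = bound#rest ; bound#rest = arg#rest }
  where open LinearLet ll

mutual
  WfIso-inv : ∀ ω → WfIso ω → WfIso (inv ω)
  WfIso-inv (clauses cs) (wfs , lhs , rhs) =
    WfClauses-invCs cs wfs ,
    subst (AllPairs Apart) (sym (map-proj₁-invCs cs)) rhs ,
    subst (AllPairs Apart) (sym (rhsVals-invCs cs)) lhs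
  WfIso-inv (fix f ω) wf = WfIso-inv ω wf
  WfIso-inv (ivar f) wf = tt

  WfClauses-invCs : ∀ cs → WfClauses cs → WfClauses (invCs cs)
  WfClauses-invCs [] wf = tt
  WfClauses-invCs ((v , e) ∷ cs) ((lin-v , lin-e , wf-e) , wfs) =
    invGo-wf e (val v) lin-e (lin-v , id , id) wf-e tt , WfClauses-invCs cs wfs

  invGo-wf : ∀ {S} e acc → LinearIn S e → LinearIn S acc → WfExpr e → WfExpr acc →
             let (v′ , e′) = invGo e acc in Linear v′ × LinearIn (vars v′) e′ × WfExpr e′
  invGo-wf (val v′) acc (lin , S⊆v′ , v′⊆S) lin-acc wf-e wf-acc =
    lin , LinearIn-resp acc S⊆v′ v′⊆S lin-acc , wf-acc
  invGo-wf (elet p ω p′ e) acc (rest , ll , lin-e) lin-acc (wf-ω , wf-e) wf-acc =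
    invGo-wf e (elet p′ (inv ω) p acc) lin-e
      (rest , LinearLet-reverse ll ,
       LinearIn-resp acc S⊆arg++rest (++-⊆ arg⊆S rest⊆S) lin-acc)
      wf-e (WfIso-inv ω wf-ω , wf-acc)
    where open LinearLet ll

invInvLets : Expr → Expr → Expr
invInvLets (val v) x = x
invInvLets (elet p ω p′ e) x = elet p (inv (inv ω)) p′ (invInvLets e x)

invGo-invGo : ∀ e acc x → invGo (proj₂ (invGo e acc)) x ≡ invGo acc (invInvLets e x)
invGo-invGo (val v) acc x = refl
invGo-invGo (elet p ω p′ e) acc x = invGo-invGo e (elet p′ (inv ω) p acc) x

mutual
  inv-involutive : ∀ ω → inv (inv ω) ≡ ω
  inv-involutive (clauses cs) = cong clauses (invCs-involutive cs)
  inv-involutive (fix f ω) = cong (fix f) (inv-involutive ω)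
  inv-involutive (ivar f) = refl

  invCs-involutive : ∀ cs → invCs (invCs cs) ≡ cs
  invCs-involutive [] = refl
  invCs-involutive ((v , e) ∷ cs) = cong₂ _∷_ inverted-clause (invCs-involutive cs)
    where
    inverted-clause : invGo (proj₂ (invGo e (val v))) (val (proj₁ (invGo e (val v)))) ≡ (v , e)
    inverted-clause = begin
      invGo (proj₂ (invGo e (val v))) (val (proj₁ (invGo e (val v))))
        ≡⟨ invGo-invGo e (val v) _ ⟩
      (v , invInvLets e (val (proj₁ (invGo e (val v)))))
        ≡⟨ cong (λ y → v , invInvLets e (val y)) (proj₁-invGo e (val v)) ⟩
      (v , invInvLets e (val (valOf e)))
        ≡⟨ cong (v ,_) (invInvLets-valOf e) ⟩
      (v , e) ∎

  invInvLets-valOf : ∀ e → invInvLets e (val (valOf e)) ≡ e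
  invInvLets-valOf (val v) = refl
  invInvLets-valOf (elet p ω p′ e) = cong₂ (λ ω′ e′ → elet p ω′ p′ e′) (inv-involutive ω) (invInvLets-valOf e)

-- Runs of clause bodies and reversibility

Eval-substEnv⇒Match : ∀ {n} ρ v {a} → Linear v → DefinedOn ρ (vars v) →
  Eval n (substEnv ρ (valT v)) a → Σ Subst λ σ → Match σ v a × lookupS σ ≗ ρ ↾ vars v
Eval-substEnv⇒Match ρ unit _ _ ev-unit = [] , m-unit , λ _ → refl
Eval-substEnv⇒Match {n} ρ (var x) {a} _ def d with u , ρx ← def (here refl)
  with refl ← Eval-valT-inv u (subst (λ m → Eval n (maybe′ valT (var x) m) a) ρx d)
  = [ (x , u) ] , m-var , σ≗
  where
  σ≗ : lookupS [ (x , u) ] ≗ ρ ↾ [ x ]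
  σ≗ y with y ≡ᵇ x in y≡ᵇx
  ... | true rewrite ≡ᵇ-true⇒≡ y x y≡ᵇx = sym ρx
  ... | false = refl
Eval-substEnv⇒Match ρ (inl v) lin def (ev-inl d) with σ , m , σ≗ ← Eval-substEnv⇒Match ρ v lin def d =
  σ , m-inl m , σ≗
Eval-substEnv⇒Match ρ (inr v) lin def (ev-inr d) with σ , m , σ≗ ← Eval-substEnv⇒Match ρ v lin def d =
  σ , m-inr m , σ≗
Eval-substEnv⇒Match ρ (fold v) lin def (ev-fold d) with σ , m , σ≗ ← Eval-substEnv⇒Match ρ v lin def d =
  σ , m-fold m , σ≗
Eval-substEnv⇒Match ρ (pair v w) (lin-v , lin-w , v#w) def (ev-pair d₁ d₂)
  with σ₁ , m₁ , σ₁≗ ← Eval-substEnv⇒Match ρ v lin-v (def ∘ ∈-++⁺ˡ) d₁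
     | σ₂ , m₂ , σ₂≗ ← Eval-substEnv⇒Match ρ w lin-w (def ∘ ∈-++⁺ʳ (vars v)) d₂
  = σ₁ ++ σ₂ ,
    m-pair m₁ m₂ (λ (x∈σ₁ , x∈σ₂) → v#w (≗↾-∈dom σ₁≗ x∈σ₁ , ≗↾-∈dom σ₂≗ x∈σ₂)) ,
    λ x → trans (lookupS-++ σ₁ σ₂ x)
                (trans (cong₂ _<∣>_ (σ₁≗ x) (σ₂≗ x)) (↾-++ ρ {vars v} {vars w} (def ∘ ∈-++⁺ˡ) x))

-- Run I ρ e u: the let-chain e, started in the environment ρ, produces u when every iso ω
-- in it is read as the relation I ω between argument and result; each let consumes the
-- bindings α of its argument and adds the bindings β of its pattern (letStep α β).
data Run (I : Iso → Val → Val → Set) : Env → Expr → Val → Set where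
  run-val : ∀ {ρ v u σ} → Match σ v u → lookupS σ ≗ ρ → Run I ρ (val v) u
  run-let : ∀ {ρ p ω p′ e u σa a w τ} →
            Match σa (patVal p′) a → lookupS σa ⊑ ρ → Closed a → I ω a w → Closed w →
            Match τ (patVal p) w → DisjointEnv (lookupS τ) (ρ ∖ lookupS σa) →
            Run I (letStep (lookupS σa) (lookupS τ) ρ) e u → Run I ρ (elet p ω p′ e) u

Run-resp : ∀ {I ρ ρ′ e u} → ρ ≗ ρ′ → Run I ρ e u → Run I ρ′ e u
Run-resp ρ≗ρ′ (run-val m σ≗ρ) = run-val m (λ x → trans (σ≗ρ x) (ρ≗ρ′ x))
Run-resp ρ≗ρ′ (run-let {σa = σa} {τ = τ} mσa σa⊑ρ ca i cw mτ τ#ρ run) =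
  run-let mσa (λ x u e → trans (sym (ρ≗ρ′ x)) (σa⊑ρ x u e)) ca i cw mτ
    (λ x u e → trans (sym (∖-congˡ (lookupS σa) ρ≗ρ′ x)) (τ#ρ x u e))
    (Run-resp (⊞-congʳ (lookupS τ) (∖-congˡ (lookupS σa) ρ≗ρ′)) run)

Evals : Iso → Val → Val → Set
Evals ω a w = Σ ℕ λ n → EvalIso n ω a w

InvEvals : Iso → Val → Val → Set
InvEvals ω a w = Evals (inv ω) w a

-- acc is the inverse of the part of the body already traversed: run from ρ, it returns the
-- clause's argument w₀.
Run-reverse : ∀ {ρ e u acc w₀} → Run InvEvals ρ e u → Run Evals ρ acc w₀ →
              let (v′ , e′) = invGo e acc in Σ Subst λ σ′ → Match σ′ v′ u × Run Evals (lookupS σ′) e′ w₀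
Run-reverse (run-val {σ = σ} m σ≗ρ) run-acc = σ , m , Run-resp (λ x → sym (σ≗ρ x)) run-acc
Run-reverse {ρ} (run-let {σa = σa} {τ = τ} mσa σa⊑ρ ca i cw mτ τ#ρ run) run-acc =
  Run-reverse run
    (run-let mτ (⊞-⊑ˡ (lookupS τ) _) cw i ca mσa (letStep-undo-disjoint (lookupS σa) (lookupS τ) ρ)
      (Run-resp (letStep-undo (lookupS σa) (lookupS τ) ρ σa⊑ρ τ#ρ) run-acc))

Run⇒Eval : ∀ {ρ e u} → Run Evals ρ e u → ∀ ρ₁ → ρ ⊑ ρ₁ → ClosedEnv ρ₁ →
           Σ ℕ λ n → Eval n (substEnv ρ₁ (toTerm e)) u
Run⇒Eval {u = u} (run-val m σ≗ρ) ρ₁ ρ⊑ρ₁ cl =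
  0 , subst (λ t → Eval 0 t u)
            (sym (match-substEnv ρ₁ m (λ x v e → ρ⊑ρ₁ x v (trans (sym (σ≗ρ x)) e))))
            (Eval-valT 0 u)
Run⇒Eval {u = u} (run-let {p = p} {p′ = p′} {e} {σa = σa} {a} {τ = τ} mσa σa⊑ρ _ (m₁ , DI) cw mτ _ run)
         ρ₁ ρ⊑ρ₁ cl
  with m₂ , Drest ← Run⇒Eval run (without (patVars p) ρ₁ ⊞ lookupS τ)
                              (letStep-⊑-without {α = lookupS σa} (match-hasDomain-pat p mτ) ρ⊑ρ₁)
                              (⊞-closed (without-closed (patVars p) cl) (match-closedEnv mτ cw))
  = suc (suc (m₁ ⊔ m₂)) ,
    Eval-letApp Darg DI mτ
      (subst (λ t → Eval m₂ t u) (sym (substT-substEnv τ (toTerm e) (without-closed (patVars p) cl))) Drest)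
  where
  Darg : Eval m₁ (substEnv ρ₁ (valT (patVal p′))) a
  Darg = subst (λ t → Eval m₁ t a) (sym (match-substEnv ρ₁ mσa (⊑-trans σa⊑ρ ρ⊑ρ₁))) (Eval-valT m₁ a)

Run-let : ∀ {S p ω p′ e rest ρ σa a w τ u} → LinearLet S p p′ rest → DefinedOn ρ S →
          Match σa (patVal p′) a → lookupS σa ≗ ρ ↾ vars (patVal p′) → Closed a →
          InvEvals ω a w → Closed w → Match τ (patVal p) w →
          Run InvEvals ((without (patVars p) ρ ⊞ lookupS τ) ↾ (patVars p ++ rest)) e u →
          Run InvEvals (ρ ↾ S) (elet p ω p′ e) u
Run-let {S} {p} {p′ = p′} {rest = rest} {ρ} {σa} {τ = τ} ll def mσa σa≗ ca i cw mτ run =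
  run-let mσa σa⊑ρ↾S ca i cw mτ τ#consumed (Run-resp env≗ run)
  where
  open LinearLet ll
  σa≗′ : lookupS σa ≗ ρ ↾ patVars p′
  σa≗′ x = trans (σa≗ x) (cong (λ xs → (ρ ↾ xs) x) (vars-patVal p′))
  consumed : (ρ ↾ S) ∖ lookupS σa ≗ ρ ↾ rest
  consumed = ↾-∖-consumed ρ σa≗′ (def ∘ arg⊆S) S⊆arg++rest rest⊆S arg#rest
  σa⊑ρ↾S : lookupS σa ⊑ ρ ↾ S
  σa⊑ρ↾S x u e = ↾-⊑ ρ arg⊆S x u (trans (sym (σa≗′ x)) e)
  τ#consumed : DisjointEnv (lookupS τ) ((ρ ↾ S) ∖ lookupS σa)
  τ#consumed x u τx =
    trans (consumed x) (↾-∉ ρ rest (λ x∈rest → bound#rest (proj₁ (match-hasDomain-pat p mτ) x u τx , x∈rest)))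
  env≗ : (without (patVars p) ρ ⊞ lookupS τ) ↾ (patVars p ++ rest) ≗ letStep (lookupS σa) (lookupS τ) (ρ ↾ S)
  env≗ x = trans (without-⊞-↾ ρ (match-hasDomain-pat p mτ) bound#rest x) (sym (⊞-congʳ (lookupS τ) consumed x))

mutual
  Eval⇒Run : ∀ n {S e ρ u} → LinearIn S e → WfExpr e → ClosedEnv ρ → DefinedOn ρ S →
             Eval n (substEnv ρ (toTerm e)) u → Closed u × Run InvEvals (ρ ↾ S) e u
  Eval⇒Run n {e = val v} {ρ} (lin , S⊆v , v⊆S) _ cl def d =
    let σ , m , σ≗ = Eval-substEnv⇒Match ρ v lin (def ∘ v⊆S) d
    in match-closed m (≗↾-closed ρ (vars v) cl σ≗) , run-val m (λ x → trans (σ≗ x) (↾-cong ρ v⊆S S⊆v x))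
  Eval⇒Run zero {e = elet _ _ _ _} _ _ _ _ ()
  Eval⇒Run (suc zero) {e = elet _ _ _ _} _ _ _ _ (ev-let () _ _)
  Eval⇒Run (suc (suc n)) {e = elet p ω p′ e} {ρ} (rest , ll , lin) (wf-ω , wf-e) cl def
           (ev-let {σ = τ} (ev-app Darg DI) mτ Drest) =
    let σa , mσa , σa≗ = Eval-substEnv⇒Match ρ (patVal p′) arg-linear (def ∘ arg⊆S ∘ ∈-vars-patVal p′) Darg
        ca = match-closed mσa (≗↾-closed ρ (vars (patVal p′)) cl σa≗)
        cw , inv-ev = inv-reverses n wf-ω ca DI
        cu , run = Eval⇒Run (suc n) lin wf-e
                     (⊞-closed (without-closed (patVars p) cl) (match-closedEnv mτ cw))
                     (without-⊞-definedOn ρ (match-hasDomain-pat p mτ) bound#rest (def ∘ rest⊆S))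
                     (subst (λ t → Eval (suc n) t _) (substT-substEnv τ (toTerm e) (without-closed (patVars p) cl)) Drest)
    in cu , Run-let ll def mσa σa≗ ca inv-ev cw mτ run
    where open LinearLet ll

  inv-reverses : ∀ n {ω a w} → WfIso ω → Closed a → EvalIso n ω a w → Closed w × InvEvals ω a w
  inv-reverses (suc n) {clauses cs} {a} (wfs , _) ca (ev-clause {v = v} {e} {σ} c∈cs mσ D) =
    let _ , lin-e , wf-e = WfClauses-∈ wfs c∈cs
        cw , run = Eval⇒Run n lin-e wf-e (match-closedEnv mσ ca) (match-definedOn mσ)
                     (subst (λ t → Eval n t _) (substT≡substEnv σ (toTerm e)) D)
        σ′ , mσ′ , run′ = Run-reverse run (run-val mσ (match-≗↾ mσ))
        m , D′ = Run⇒Eval run′ (lookupS σ′) (λ _ _ e → e) (match-closedEnv mσ′ cw)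
    in cw , suc m , ev-clause (invCs-∈ c∈cs) mσ′
                      (subst (λ t → Eval m t a) (sym (substT≡substEnv σ′ (toTerm (proj₂ (invGo e (val v)))))) D′)
  inv-reverses (suc n) {fix f ω} {w = w} wf ca (ev-fix D) =
    let cw , m , D′ = inv-reverses n (WfIso-unfold f ω wf) ca D
    in cw , suc m , ev-fix (subst (λ ω′ → EvalIso m ω′ w _) (inv-substI f (fix f ω) ω) D′)

-- Determinism

WfTerm : Term → Set
WfTerm unit = ⊤
WfTerm (var x) = ⊤
WfTerm (inl t) = WfTerm t
WfTerm (inr t) = WfTerm t
WfTerm (pair t u) = WfTerm t × WfTerm u
WfTerm (fold t) = WfTerm t
WfTerm (app ω t) = WfIso ω × WfTerm t
WfTerm (tlet p t u) = WfTerm t × WfTerm u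

WfTerm-valT : ∀ v → WfTerm (valT v)
WfTerm-valT unit = tt
WfTerm-valT (var x) = tt
WfTerm-valT (inl v) = WfTerm-valT v
WfTerm-valT (inr v) = WfTerm-valT v
WfTerm-valT (pair v w) = WfTerm-valT v , WfTerm-valT w
WfTerm-valT (fold v) = WfTerm-valT v

WfTerm-substT : ∀ σ t → WfTerm t → WfTerm (substT σ t)
WfTerm-substT σ unit wf = tt
WfTerm-substT σ (var x) wf = maybe {B = λ m → WfTerm (maybe′ valT (var x) m)} WfTerm-valT tt (lookupS σ x)
WfTerm-substT σ (inl t) wf = WfTerm-substT σ t wf
WfTerm-substT σ (inr t) wf = WfTerm-substT σ t wf
WfTerm-substT σ (pair t u) (wf-t , wf-u) = WfTerm-substT σ t wf-t , WfTerm-substT σ u wf-u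
WfTerm-substT σ (fold t) wf = WfTerm-substT σ t wf
WfTerm-substT σ (app ω t) (wf-ω , wf-t) = wf-ω , WfTerm-substT σ t wf-t
WfTerm-substT σ (tlet p t u) (wf-t , wf-u) = WfTerm-substT σ t wf-t , WfTerm-substT _ u wf-u

WfExpr⇒WfTerm : ∀ e → WfExpr e → WfTerm (toTerm e)
WfExpr⇒WfTerm (val v) _ = WfTerm-valT v
WfExpr⇒WfTerm (elet p ω p′ e) (wf-ω , wf-e) = (wf-ω , WfTerm-valT (patVal p′)) , WfExpr⇒WfTerm e wf-e

matching-clause-unique : ∀ {cs} {c₁ c₂ : Val × Expr} {σ₁ σ₂ a} →
                         AllPairs Apart (map proj₁ cs) → c₁ ∈ cs → c₂ ∈ cs →
                         Match σ₁ (proj₁ c₁) a → Match σ₂ (proj₁ c₂) a → c₁ ≡ c₂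
matching-clause-unique lhs c₁∈cs c₂∈cs m₁ m₂ with AllPairs-∈ (AllPairsₚ.map⁻ lhs) c₁∈cs c₂∈cs
... | inj₁ c₁≡c₂ = c₁≡c₂
... | inj₂ (inj₁ apart) = ⊥-elim (Apart⇒¬matchBoth apart m₁ m₂)
... | inj₂ (inj₂ apart) = ⊥-elim (Apart⇒¬matchBoth apart m₂ m₁)

mutual
  Eval-deterministic : ∀ {t n m u₁ u₂} → WfTerm t → Eval n t u₁ → Eval m t u₂ → u₁ ≡ u₂
  Eval-deterministic wf ev-unit ev-unit = refl
  Eval-deterministic wf ev-var ev-var = refl
  Eval-deterministic wf (ev-inl d) (ev-inl d′) = cong inl (Eval-deterministic wf d d′)
  Eval-deterministic wf (ev-inr d) (ev-inr d′) = cong inr (Eval-deterministic wf d d′)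
  Eval-deterministic wf (ev-fold d) (ev-fold d′) = cong fold (Eval-deterministic wf d d′)
  Eval-deterministic (wf-t , wf-u) (ev-pair d e) (ev-pair d′ e′) =
    cong₂ pair (Eval-deterministic wf-t d d′) (Eval-deterministic wf-u e e′)
  Eval-deterministic (wf-ω , wf-t) (ev-app d i) (ev-app d′ i′)
    with refl ← Eval-deterministic wf-t d d′ = EvalIso-deterministic wf-ω i i′
  Eval-deterministic {tlet p t u} (wf-t , wf-u) (ev-let {σ = σ} d m e) (ev-let d′ m′ e′)
    with refl ← Eval-deterministic wf-t d d′ with refl ← match-unique m m′ =
    Eval-deterministic (WfTerm-substT σ u wf-u) e e′

  EvalIso-deterministic : ∀ {ω n m a w₁ w₂} → WfIso ω → EvalIso n ω a w₁ → EvalIso m ω a w₂ → w₁ ≡ w₂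
  EvalIso-deterministic (wfs , lhs , _) (ev-clause {e = e} {σ} c∈cs m d) (ev-clause c′∈cs m′ d′)
    with refl ← matching-clause-unique lhs c∈cs c′∈cs m m′ with refl ← match-unique m m′ =
    Eval-deterministic (WfTerm-substT σ (toTerm e) (WfExpr⇒WfTerm e (proj₂ (proj₂ (WfClauses-∈ wfs c∈cs))))) d d′
  EvalIso-deterministic {fix f ω} wf (ev-fix i) (ev-fix i′) = EvalIso-deterministic (WfIso-unfold f ω wf) i i′

-- Typed isos are well formed

Unique⇒Linear : ∀ v → Unique (vars v) → Linear v
Unique⇒Linear unit u = tt
Unique⇒Linear (var x) u = tt
Unique⇒Linear (inl v) u = Unique⇒Linear v u
Unique⇒Linear (inr v) u = Unique⇒Linear v u
Unique⇒Linear (fold v) u = Unique⇒Linear v u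
Unique⇒Linear (pair v w) u =
  let uv , uw , v#w = Unique-++⁻ (vars v) u in Unique⇒Linear v uv , Unique⇒Linear w uw , v#w

vars⊆[]⇒Closed : ∀ v → vars v ⊆ [] → Closed v
vars⊆[]⇒Closed unit _ = tt
vars⊆[]⇒Closed (var x) v⊆[] with () ← v⊆[] (here refl)
vars⊆[]⇒Closed (inl v) v⊆[] = vars⊆[]⇒Closed v v⊆[]
vars⊆[]⇒Closed (inr v) v⊆[] = vars⊆[]⇒Closed v v⊆[]
vars⊆[]⇒Closed (fold v) v⊆[] = vars⊆[]⇒Closed v v⊆[]
vars⊆[]⇒Closed (pair v w) vw⊆[] =
  vars⊆[]⇒Closed v (vw⊆[] ∘ ∈-++⁺ˡ) , vars⊆[]⇒Closed w (vw⊆[] ∘ ∈-++⁺ʳ (vars v))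

ctxDom : Ctx → List ℕ
ctxDom = map proj₁

ctxDom-↭ : ∀ {Δ : Ctx} Δ₁ Δ₂ → Δ ↭ Δ₁ ++ Δ₂ → ctxDom Δ ↭ ctxDom Δ₁ ++ ctxDom Δ₂
ctxDom-↭ Δ₁ Δ₂ Δ↭ = subst (_ ↭_) (map-++ proj₁ Δ₁ Δ₂) (Permutationₚ.map⁺ proj₁ Δ↭)

ctxDom-split : ∀ {Δ : Ctx} Δ₁ Δ₂ → Δ ↭ Δ₁ ++ Δ₂ → ctxDom Δ ⊆ ctxDom Δ₁ ++ ctxDom Δ₂
ctxDom-split Δ₁ Δ₂ Δ↭ = ⊆-reflexive-↭ (ctxDom-↭ Δ₁ Δ₂ Δ↭)

ctxDom-join : ∀ {Δ : Ctx} Δ₁ Δ₂ → Δ ↭ Δ₁ ++ Δ₂ → ctxDom Δ₁ ++ ctxDom Δ₂ ⊆ ctxDom Δ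
ctxDom-join Δ₁ Δ₂ Δ↭ = ⊆-reflexive-↭ (↭-sym (ctxDom-↭ Δ₁ Δ₂ Δ↭))

ctxDom-disjoint : ∀ {Δ : Ctx} Δ₁ Δ₂ → Unique (ctxDom Δ) → Δ ↭ Δ₁ ++ Δ₂ → Disjoint (ctxDom Δ₁) (ctxDom Δ₂)
ctxDom-disjoint Δ₁ Δ₂ u Δ↭ =
  proj₂ (proj₂ (Unique-++⁻ (ctxDom Δ₁)
    (Permutationₛ.Unique-resp-↭ (setoid ℕ) (↭⇒↭ₛ (ctxDom-↭ Δ₁ Δ₂ Δ↭)) u)))

typed⇒Unique : ∀ {Δ Ψ t A} → Δ ︔ Ψ ⊢ t ∶ A → Unique (ctxDom Δ)
typed⇒Unique t-unit = []
typed⇒Unique t-var = [] ∷ []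
typed⇒Unique (t-inl d) = typed⇒Unique d
typed⇒Unique (t-inr d) = typed⇒Unique d
typed⇒Unique (t-pair _ _ _ u) = u
typed⇒Unique (t-fold d) = typed⇒Unique d
typed⇒Unique (t-appf _ d) = typed⇒Unique d
typed⇒Unique (t-app _ d) = typed⇒Unique d
typed⇒Unique (t-let _ _ _ _ u) = u

PatTy-ctxDom : ∀ {p A Δp} → PatTy p A Δp → ctxDom Δp ≡ patVars p
PatTy-ctxDom pt-var = refl
PatTy-ctxDom (pt-pair {x = x} pt) = cong (x ∷_) (PatTy-ctxDom pt)

valT-typed⇒LinearIn : ∀ {Δ Ψ B} v → Δ ︔ Ψ ⊢ valT v ∶ B → LinearIn (ctxDom Δ) (val v)
valT-typed⇒LinearIn unit t-unit = tt , (λ ()) , (λ ())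
valT-typed⇒LinearIn (var x) t-var = tt , id , id
valT-typed⇒LinearIn (inl v) (t-inl d) = valT-typed⇒LinearIn v d
valT-typed⇒LinearIn (inr v) (t-inr d) = valT-typed⇒LinearIn v d
valT-typed⇒LinearIn (fold v) (t-fold d) = valT-typed⇒LinearIn v d
valT-typed⇒LinearIn (pair v w) (t-pair {Δ₁ = Δ₁} {Δ₂} d₁ d₂ Δ↭ u) =
  let lin-v , Δ₁⊆v , v⊆Δ₁ = valT-typed⇒LinearIn v d₁
      lin-w , Δ₂⊆w , w⊆Δ₂ = valT-typed⇒LinearIn w d₂
  in (lin-v , lin-w , λ (x∈v , x∈w) → ctxDom-disjoint Δ₁ Δ₂ u Δ↭ (v⊆Δ₁ x∈v , w⊆Δ₂ x∈w)) ,
     ⊆-trans (ctxDom-split Δ₁ Δ₂ Δ↭) (++⁺ Δ₁⊆v Δ₂⊆w) ,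
     ⊆-trans (++⁺ v⊆Δ₁ w⊆Δ₂) (ctxDom-join Δ₁ Δ₂ Δ↭)

let-typed⇒LinearIn : ∀ {Δ Δp Ψ p ω p′ e A′ A} Δ₁ Δ₂ →
  Δ₁ ︔ Ψ ⊢ valT (patVal p′) ∶ A′ → PatTy p A Δp →
  LinearIn (ctxDom (Δ₂ ++ Δp)) e → Unique (ctxDom (Δ₂ ++ Δp)) → Δ ↭ Δ₁ ++ Δ₂ → Unique (ctxDom Δ) →
  LinearIn (ctxDom Δ) (elet p ω p′ e)
let-typed⇒LinearIn {Δp = Δp} {p = p} {p′ = p′} {e} Δ₁ Δ₂ d-arg pt lin-e u-body Δ↭ u =
  ctxDom Δ₂ , ll , LinearIn-resp e (++-⊆ (xs⊆ys++xs _ (patVars p)) (xs⊆xs++ys _ _))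
                                   (++-⊆ (xs⊆ys++xs _ (ctxDom Δ₂)) (xs⊆xs++ys _ _)) lin-e′
  where
  body-ctx : ctxDom (Δ₂ ++ Δp) ≡ ctxDom Δ₂ ++ patVars p
  body-ctx = trans (map-++ proj₁ Δ₂ Δp) (cong (ctxDom Δ₂ ++_) (PatTy-ctxDom pt))
  lin-e′ : LinearIn (ctxDom Δ₂ ++ patVars p) e
  lin-e′ = subst (λ S → LinearIn S e) body-ctx lin-e
  u-body′ : Unique (ctxDom Δ₂ ++ patVars p)
  u-body′ = subst Unique body-ctx u-body
  lin-arg = valT-typed⇒LinearIn (patVal p′) d-arg
  Δ₁⊆arg : ctxDom Δ₁ ⊆ patVars p′
  Δ₁⊆arg = ∈-vars-patVal p′ ∘ proj₁ (proj₂ lin-arg)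
  arg⊆Δ₁ : patVars p′ ⊆ ctxDom Δ₁
  arg⊆Δ₁ = proj₂ (proj₂ lin-arg) ∘ ∈-patVars p′
  ll : LinearLet (ctxDom _) p p′ (ctxDom Δ₂)
  ll = record
    { arg-linear = proj₁ lin-arg
    ; bound-linear = Unique⇒Linear (patVal p)
        (subst Unique (sym (vars-patVal p)) (proj₁ (proj₂ (Unique-++⁻ (ctxDom Δ₂) u-body′))))
    ; S⊆arg++rest = ⊆-trans (ctxDom-split Δ₁ Δ₂ Δ↭) (++⁺ Δ₁⊆arg id)
    ; arg⊆S = ctxDom-join Δ₁ Δ₂ Δ↭ ∘ ∈-++⁺ˡ ∘ arg⊆Δ₁
    ; rest⊆S = ctxDom-join Δ₁ Δ₂ Δ↭ ∘ ∈-++⁺ʳ (ctxDom Δ₁)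
    ; arg#rest = λ (x∈arg , x∈rest) → ctxDom-disjoint Δ₁ Δ₂ u Δ↭ (arg⊆Δ₁ x∈arg , x∈rest)
    ; bound#rest = λ (x∈bound , x∈rest) → proj₂ (proj₂ (Unique-++⁻ (ctxDom Δ₂) u-body′)) (x∈rest , x∈bound)
    }

mutual
  typed⇒WfIso : ∀ {Ψ ω α} → Ψ ⊢ω ω ∶ α → WfIso ω
  typed⇒WfIso (i-clauses cts odˡ odʳ) = typed⇒WfClauses cts , OD⇒AllPairs-Apart odˡ , OD⇒AllPairs-Apart odʳ
  typed⇒WfIso i-var = tt
  typed⇒WfIso (i-fix d _) = typed⇒WfIso d

  typed⇒WfClauses : ∀ {Ψ A B cs} → All (ClauseTy Ψ A B) cs → WfClauses cs
  typed⇒WfClauses [] = tt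
  typed⇒WfClauses (clause {v} {e} Δ dv de ∷ cts) =
    let lin-v , Δ⊆v , v⊆Δ = valT-typed⇒LinearIn v dv
        lin-e , wf-e = typed⇒LinearIn×WfExpr e de
    in (lin-v , LinearIn-resp e Δ⊆v v⊆Δ lin-e , wf-e) , typed⇒WfClauses cts

  typed⇒LinearIn×WfExpr : ∀ {Δ Ψ B} e → Δ ︔ Ψ ⊢ toTerm e ∶ B → LinearIn (ctxDom Δ) e × WfExpr e
  typed⇒LinearIn×WfExpr (val v) d = valT-typed⇒LinearIn v d , tt
  typed⇒LinearIn×WfExpr (elet p ω p′ e) (t-let {Δ₁ = Δ₁} {Δ₂} pt (t-appf _ d-arg) d-body Δ↭ u) =
    let lin-e , wf-e = typed⇒LinearIn×WfExpr e d-body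
    in let-typed⇒LinearIn {ω = ω} Δ₁ Δ₂ d-arg pt lin-e (typed⇒Unique d-body) Δ↭ u , tt , wf-e
  typed⇒LinearIn×WfExpr (elet p ω p′ e) (t-let {Δ₁ = Δ₁} {Δ₂} pt (t-app dω d-arg) d-body Δ↭ u) =
    let lin-e , wf-e = typed⇒LinearIn×WfExpr e d-body
    in let-typed⇒LinearIn {ω = ω} Δ₁ Δ₂ d-arg pt lin-e (typed⇒Unique d-body) Δ↭ u , typed⇒WfIso dω , wf-e

mainTheorem7 : ∀ {ω A B v v′} →
    nothing ⊢ω ω ∶ (A ↔ B) →
    [] ︔ nothing ⊢ valT v ∶ B →
    app ω (app (inv ω) (valT v)) ⟶* valT v′ →
    v ≡ v′
mainTheorem7 {ω} {v = v} dω dv ω∘ω⊥⟶*v′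
  with _ , ev-app (ev-app dv⇓ ω⊥v⇓u) ωu⇓v′ ← ⟶*⇒Eval ω∘ω⊥⟶*v′
  with refl ← Eval-valT-inv v dv⇓ =
  let wf = typed⇒WfIso dω
      v-closed = vars⊆[]⇒Closed v (proj₂ (proj₂ (valT-typed⇒LinearIn v dv)))
      _ , m , ωu⇓v = inv-reverses _ (WfIso-inv ω wf) v-closed ω⊥v⇓u
  in EvalIso-deterministic wf (subst (λ ω′ → EvalIso m ω′ _ v) (inv-involutive ω) ωu⇓v) ωu⇓v′
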